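{- For every integer $n\ge 0$, $\mathrm{pk}_n(132)=\mathrm{pk}_n(231)=p_n$, where the sequence $(p_n)_{n\ge0}$ is defined by $p_0=1$ and $p_n=\sum_{k=1}^n k\,p_{k-1}p_{n-k}$ for $n\ge1$. Consequently the formal power series $P(x)=\sum_{n\ge0}p_nx^n$ satisfies $x^2P(x)P'(x)+x(P(x))^2-P(x)+1=0$.
   Context: For a positive integer $n$, $[n]=\{1,\dots,n\}$. A function $f:[n]\to[n]$ is a parking function if for every $i\in[n]$, $|\{j\in[n]: f(j)\le i\}|\ge i$. Equivalently: $n$ cars enter one at a time a one-way street with spots $1,\dots,n$; car $i$ drives to spot $f(i)$ and parks in the first free spot at or after $f(i)$; $f$ is a parking function iff all cars park. The parking permutation $\rho_f\in S_n$ of a parking function $f$ is defined by: spot $i$ is occupied by car $\rho_f(i)$. A permutation $\pi\in S_n$ contains $\sigma\in S_m$ as a pattern if there exist $1\le i_1<\dots<i_m\le n$ with $\pi(i_a)<\pi(i_b)$ iff $\sigma(a)<\sigma(b)$ for all $a,b\in[m]$; otherwise $\pi$ avoids $\sigma$. For permutations $\sigma_1,\dots,\sigma_k$, $\mathrm{pk}_n(\sigma_1,\dots,\sigma_k)$ denotes the number of parking functions $f:[n]\to[n]$ whose parking permutation $\rho_f$ avoids every $\sigma_i$; by convention $\mathrm{pk}_0(\cdot)=1$. -}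

module Defs where

open import Data.Nat using (ℕ; zero; suc; _+_; _*_; _∸_; _≤_; _<_)
open import Data.Nat.Properties using (_≤?_)
open import Data.Fin as F using (Fin; toℕ)
open import Data.Fin.Properties as FP using ()
open import Data.Vec using (Vec; []; _∷_; lookup; replicate; count)
open import Data.Maybe using (Maybe; just; nothing; fromMaybe)
open import Data.List using (List; length)
open import Data.List.Membership.Propositional using (_∈_)
open import Data.List.Relation.Unary.Unique.Propositional using (Unique)
open import Data.Product using (Σ; ∃; _×_)
open import Relation.Nullary using (¬_)
open import Relation.Binary.PropositionalEquality using (_≡_)
open import Data.Integer as ℤ using (ℤ)

-- Parking functions.  A function f : [n] → [n] is represented as a
-- vector  f : Vec (Fin n) n , with car i ∈ [n] being index i-1 and
-- spot s ∈ [n] being the element s-1 of Fin n (0-based shift).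

countLe : ∀ {n} → Vec (Fin n) n → Fin n → ℕ
countLe f i = count (λ x → toℕ x ≤? toℕ i) f

-- f is a parking function: for every i ∈ [n], |{j : f(j) ≤ i}| ≥ i.
-- (i here is the 0-based index, so the 1-based value is suc (toℕ i).)
IsParking : ∀ {n} → Vec (Fin n) n → Set
IsParking {n} f = (i : Fin n) → suc (toℕ i) ≤ countLe f i

-- The parking process.  Street occupancy: Vec (Maybe ℕ) n, spot s holds
-- `just c` if car c (1-based label) occupies it, `nothing` if free.

parkFrom : ∀ {k} → ℕ → ℕ → Vec (Maybe ℕ) k → Vec (Maybe ℕ) k
parkFrom s       c []            = []
parkFrom zero    c (nothing ∷ v) = just c ∷ v
parkFrom zero    c (just x ∷ v)  = just x ∷ parkFrom zero c v
parkFrom (suc s) c (x ∷ v)       = x ∷ parkFrom s c v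

parkAll : ∀ {n k} → ℕ → Vec (Fin n) k → Vec (Maybe ℕ) n → Vec (Maybe ℕ) n
parkAll c []       occ = occ
parkAll c (p ∷ ps) occ = parkAll (suc c) ps (parkFrom (toℕ p) c occ)

occupancy : ∀ {n} → Vec (Fin n) n → Vec (Maybe ℕ) n
occupancy {n} f = parkAll 1 f (replicate n nothing)

-- Parking permutation ρ_f : spot i ↦ (1-based) label of car parked there.
-- (For a parking function every spot is occupied; the default 0 is
-- never used in that case.)
parkingPerm : ∀ {n} → Vec (Fin n) n → Fin n → ℕ
parkingPerm f i = fromMaybe 0 (lookup (occupancy f) i)

-- A pattern σ ∈ S_m is given by its one-line
-- notation as a vector of naturals (e.g. 132 = 1 ∷ 3 ∷ 2 ∷ []).
-- π contains σ iff there are indices i_1 < … < i_m with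
-- π(i_a) < π(i_b) ⇔ σ(a) < σ(b) for all a, b.
Contains : ∀ {n m} → (Fin n → ℕ) → Vec ℕ m → Set
Contains {n} {m} π σ =
  Σ (Fin m → Fin n) λ ι →
    ((a b : Fin m) → a F.< b → ι a F.< ι b) ×
    ((a b : Fin m) → (π (ι a) < π (ι b) → lookup σ a < lookup σ b)
                   × (lookup σ a < lookup σ b → π (ι a) < π (ι b)))

Avoids : ∀ {n m} → (Fin n → ℕ) → Vec ℕ m → Set
Avoids π σ = ¬ Contains π σ

PkProp : (n : ℕ) → ∀ {m} → Vec ℕ m → Vec (Fin n) n → Set
PkProp n σ f = IsParking f × Avoids (parkingPerm f) σ

HasCard : {A : Set} → (A → Set) → ℕ → Set
HasCard {A} P k =
  Σ (List A) λ L → Unique L × ((x : A) → (x ∈ L → P x) × (P x → x ∈ L)) × length L ≡ k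

PkEq : (n : ℕ) → ∀ {m} → Vec ℕ m → ℕ → Set
PkEq n σ k = HasCard (PkProp n σ) k

pat132 : Vec ℕ 3
pat132 = 1 ∷ 3 ∷ 2 ∷ []

pat231 : Vec ℕ 3
pat231 = 2 ∷ 3 ∷ 1 ∷ []

sum1 : ℕ → (ℕ → ℕ) → ℕ
sum1 zero    g = 0
sum1 (suc n) g = sum1 n g + g (suc n)

sumℤ0 : ℕ → (ℕ → ℤ) → ℤ
sumℤ0 zero    g = g 0
sumℤ0 (suc n) g = sumℤ0 n g ℤ.+ g (suc n)

FPS : Set
FPS = ℕ → ℤ

_⊕_ : FPS → FPS → FPS
(a ⊕ b) n = a n ℤ.+ b n

⊖_ : FPS → FPS
(⊖ a) n = ℤ.- a n

_⊛_ : FPS → FPS → FPS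
(a ⊛ b) n = sumℤ0 n (λ i → a i ℤ.* b (n ∸ i))

deriv : FPS → FPS
deriv a n = ℤ.+ (suc n) ℤ.* a (suc n)

xS : FPS
xS 1 = ℤ.+ 1
xS _ = ℤ.+ 0

oneS : FPS
oneS 0 = ℤ.+ 1
oneS _ = ℤ.+ 0

-- the zero series is tested coefficientwise

{-# OPTIONS --safe #-}
module Submission where

-- The last car n+1 parks in some spot s+1, which
-- is the only spot still free when it arrives; hence it preferred one of the s+1
-- spots 1,…,s+1, the cars parked to its left all preferred spots ≤ s and form a
-- parking function of length s, and the cars parked to its right form one of
-- length n−s (after shifting their preferences by s+1).  The parking permutation is
-- A (n+1) B, so it avoids 132 iff A and B do and every car in A arrived after every
-- car in B (for 231: before); conversely every such assembly is admissible.  This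
-- gives p_{n+1} = Σ_s (s+1) p_s p_{n−s}, and the power-series identity is this
-- recurrence read off coefficientwise.

open import Defs
open import Data.Nat using (ℕ; zero; suc; _+_; _*_; _∸_; _<_; _≤_; z≤n; s≤s; _<?_; _≤?_; _≤ᵇ_)
open import Data.Nat.Properties
open import Algebra.Properties.CommutativeSemigroup +-commutativeSemigroup using (interchange)
open import Data.Bool using (if_then_else_)
open import Data.Fin using (Fin; toℕ; fromℕ<)
import Data.Fin as Fin
open import Data.Fin.Properties using (toℕ-fromℕ<; fromℕ<-toℕ; toℕ<n)
open import Data.Vec using (Vec; []; _∷_)
import Data.Vec as Vec
open import Data.Maybe using (Maybe; just; nothing; fromMaybe) renaming (map to mapMaybe)
open import Data.Maybe.Relation.Unary.All as Maybe using (just; nothing)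
import Data.Integer as ℤ
import Data.Integer.Properties as ℤᵖ
open import Data.List using (List; []; _∷_; [_]; length; map; _++_; _∷ʳ_; take; replicate; upTo; cartesianProduct; initLast; _∷ʳ′_)
open import Data.List.Properties
  using (length-map; length-++; length-upTo; length-replicate; map-++; map-replicate; map-∘; map-id-local; ++-assoc; ++-identityʳ;
         ∷-injectiveˡ; ∷-injectiveʳ; ∷ʳ-injective; map-injective)
open import Data.List.Membership.Propositional using (_∈_)
open import Data.List.Membership.Propositional.Properties
  using (∈-map⁺; ∈-map⁻; ∈-++⁺ˡ; ∈-++⁺ʳ; ∈-++⁻; ∈-cartesianProduct⁺; ∈-cartesianProduct⁻; ∈-upTo⁺; ∈-upTo⁻)
open import Data.List.Relation.Unary.Any using (here; there)
open import Data.List.Relation.Unary.All using (All; []; _∷_)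
import Data.List.Relation.Unary.All as All
import Data.List.Relation.Unary.All.Properties as All
open import Data.List.Relation.Unary.AllPairs using ([]; _∷_)
open import Data.List.Relation.Unary.Unique.Propositional using (Unique)
import Data.List.Relation.Unary.Unique.Propositional.Properties as Unique
open import Data.Product using (∃; _×_; _,_; proj₁; proj₂)
import Data.Product as Product
open import Data.Sum using (_⊎_; inj₁; inj₂)
import Data.Sum as Sum
open import Data.Empty using (⊥-elim)
open import Function using (_∘_; id)
open import Relation.Nullary using (¬_; yes; no)
open import Relation.Binary using (tri<; tri≈; tri>)
open import Relation.Binary.PropositionalEquality
  using (_≡_; _≢_; refl; sym; trans; cong; cong₂; subst; subst₂; module ≡-Reasoning)

module Cardinality where

  unique-map⁺ : ∀ {A B : Set} (f : A → B) (L : List A) →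
                (∀ {x y} → x ∈ L → y ∈ L → f x ≡ f y → x ≡ y) → Unique L → Unique (map f L)
  unique-map⁺ f []      inj []       = []
  unique-map⁺ f (x ∷ L) inj (x∉ ∷ u) =
    fresh L (λ y∈ → inj (here refl) (there y∈)) x∉ ∷ unique-map⁺ f L (λ x∈ y∈ → inj (there x∈) (there y∈)) u
    where
    fresh : ∀ L → (∀ {y} → y ∈ L → f x ≡ f y → x ≡ y) → All (x ≢_) L → All (f x ≢_) (map f L)
    fresh []      inj []         = []
    fresh (y ∷ L) inj (x≢y ∷ ps) = (x≢y ∘ inj (here refl)) ∷ fresh L (inj ∘ there) ps

  module _ {A : Set} where

    HasCard-cong : ∀ {P Q : A → Set} {k} → (∀ x → P x → Q x) → (∀ x → Q x → P x) → HasCard P k → HasCard Q k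
    HasCard-cong P⇒Q Q⇒P (L , u , L⇔P , len) = L , u , (λ x → P⇒Q x ∘ proj₁ (L⇔P x) , proj₂ (L⇔P x) ∘ Q⇒P x) , len

    HasCard-∅ : ∀ {P : A → Set} → (∀ x → ¬ P x) → HasCard P 0
    HasCard-∅ ¬P = [] , [] , (λ x → (λ ()) , ⊥-elim ∘ ¬P x) , refl

    HasCard-⊎ : ∀ {P Q : A → Set} {a b} → HasCard P a → HasCard Q b → (∀ x → P x → ¬ Q x) →
                HasCard (λ x → P x ⊎ Q x) (a + b)
    HasCard-⊎ (L₁ , u₁ , m₁ , l₁) (L₂ , u₂ , m₂ , l₂) disjoint =
      L₁ ++ L₂ ,
      Unique.++⁺ u₁ u₂ (λ { {x} (x∈₁ , x∈₂) → disjoint x (proj₁ (m₁ x) x∈₁) (proj₁ (m₂ x) x∈₂) }) ,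
      (λ x → Sum.map (proj₁ (m₁ x)) (proj₁ (m₂ x)) ∘ ∈-++⁻ L₁ ,
             Sum.[ ∈-++⁺ˡ ∘ proj₂ (m₁ x) , ∈-++⁺ʳ L₁ ∘ proj₂ (m₂ x) ]) ,
      trans (length-++ L₁) (cong₂ _+_ l₁ l₂)

    HasCard-image : ∀ {B : Set} {P : A → Set} {k} (f : A → B) →
                    (∀ {x y} → P x → P y → f x ≡ f y → x ≡ y) → HasCard P k →
                    HasCard (λ z → ∃ λ x → P x × z ≡ f x) k
    HasCard-image f inj (L , u , m , l) =
      map f L ,
      unique-map⁺ f L (λ x∈ y∈ → inj (proj₁ (m _) x∈) (proj₁ (m _) y∈)) u ,
      (λ z → image z , λ { (x , px , refl) → ∈-map⁺ f (proj₂ (m x) px) }) ,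
      trans (length-map f L) l
      where
      image : ∀ z → z ∈ map f L → ∃ λ x → _ × z ≡ f x
      image z z∈ with x , x∈ , z≡ ← ∈-map⁻ f z∈ = x , proj₁ (m x) x∈ , z≡

  HasCard-< : ∀ k → HasCard (_< k) k
  HasCard-< k = upTo k , Unique.applyUpTo⁺₁ id k (λ i<j _ → <⇒≢ i<j) , (λ _ → ∈-upTo⁻ , ∈-upTo⁺) , length-upTo k

  length-cartesianProduct : ∀ {A B : Set} (xs : List A) (ys : List B) →
                            length (cartesianProduct xs ys) ≡ length xs * length ys
  length-cartesianProduct []       ys = refl
  length-cartesianProduct (x ∷ xs) ys =
    trans (length-++ (map (x ,_) ys)) (cong₂ _+_ (length-map (x ,_) ys) (length-cartesianProduct xs ys))

  HasCard-× : ∀ {A B : Set} {P : A → Set} {Q : B → Set} {a b} → HasCard P a → HasCard Q b →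
              HasCard (λ (z : A × B) → P (proj₁ z) × Q (proj₂ z)) (a * b)
  HasCard-× (L₁ , u₁ , m₁ , l₁) (L₂ , u₂ , m₂ , l₂) =
    cartesianProduct L₁ L₂ ,
    Unique.cartesianProduct⁺ u₁ u₂ ,
    (λ { (x , y) → (λ xy∈ → let x∈ , y∈ = ∈-cartesianProduct⁻ L₁ L₂ xy∈ in proj₁ (m₁ x) x∈ , proj₁ (m₂ y) y∈) ,
                   (λ { (px , qy) → ∈-cartesianProduct⁺ (proj₂ (m₁ x) px) (proj₂ (m₂ y) qy) }) }) ,
    trans (length-cartesianProduct L₁ L₂) (cong₂ _*_ l₁ l₂)

  HasCard-bijection : ∀ {A B : Set} {P : A → Set} {Q : B → Set} {k} (to : A → B) (from : B → A) →
                      (∀ a → P a → from (to a) ≡ a) → (∀ b → to (from b) ≡ b) →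
                      (∀ b → Q b → P (from b)) → (∀ b → P (from b) → Q b) → HasCard P k → HasCard Q k
  HasCard-bijection {P = P} {Q} to from from∘to to∘from Q⇒P P⇒Q card =
    HasCard-cong image⇒Q Q⇒image (HasCard-image to injective card)
    where
    injective : ∀ {x y} → P x → P y → to x ≡ to y → x ≡ y
    injective {x} {y} px py e = trans (sym (from∘to x px)) (trans (cong from e) (from∘to y py))
    image⇒Q : ∀ b → (∃ λ a → P a × b ≡ to a) → Q b
    image⇒Q b (a , pa , refl) = P⇒Q (to a) (subst P (sym (from∘to a pa)) pa)
    Q⇒image : ∀ b → Q b → ∃ λ a → P a × b ≡ to a
    Q⇒image b qb = from b , Q⇒P b qb , sym (to∘from b)

module Street where

  Street : Set
  Street = List (Maybe ℕ)

  park : ℕ → ℕ → Street → Street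
  park s       c []            = []
  park zero    c (nothing ∷ o) = just c ∷ o
  park zero    c (just x ∷ o)  = just x ∷ park zero c o
  park (suc s) c (x ∷ o)       = x ∷ park s c o

  parkCars : List (ℕ × ℕ) → Street → Street
  parkCars []            o = o
  parkCars ((c , p) ∷ L) o = parkCars L (park p c o)

  label : ℕ → List ℕ → List (ℕ × ℕ)
  label c []       = []
  label c (p ∷ ps) = (c , p) ∷ label (suc c) ps

  vacant : ℕ → Street
  vacant n = replicate n nothing

  spot : Street → ℕ → Maybe ℕ
  spot []      i       = nothing
  spot (x ∷ o) zero    = x
  spot (x ∷ o) (suc i) = spot o i

  occupied : Maybe ℕ → ℕ
  occupied nothing  = 0
  occupied (just _) = 1

  taken : Street → ℕ
  taken []      = 0
  taken (x ∷ o) = occupied x + taken o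

  indicator≤ : ℕ → ℕ → ℕ
  indicator≤ zero    s       = 1
  indicator≤ (suc p) zero    = 0
  indicator≤ (suc p) (suc s) = indicator≤ p s

  countAtMost : ℕ → List ℕ → ℕ
  countAtMost i []       = 0
  countAtMost i (p ∷ ps) = indicator≤ p i + countAtMost i ps

  IsParkingList : ℕ → List ℕ → Set
  IsParkingList n ps = ∀ i → i < n → suc i ≤ countAtMost i ps

  length-park : ∀ p c o → length (park p c o) ≡ length o
  length-park p       c []            = refl
  length-park zero    c (nothing ∷ o) = refl
  length-park zero    c (just x ∷ o)  = cong suc (length-park zero c o)
  length-park (suc p) c (x ∷ o)       = cong suc (length-park p c o)

  length-parkCars : ∀ L o → length (parkCars L o) ≡ length o
  length-parkCars []            o = refl
  length-parkCars ((c , p) ∷ L) o = trans (length-parkCars L (park p c o)) (length-park p c o)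

  length-vacant : ∀ n → length (vacant n) ≡ n
  length-vacant n = length-replicate n

  length-parkCars-vacant : ∀ L n → length (parkCars L (vacant n)) ≡ n
  length-parkCars-vacant L n = trans (length-parkCars L (vacant n)) (length-vacant n)

  length-label : ∀ c ps → length (label c ps) ≡ length ps
  length-label c []       = refl
  length-label c (p ∷ ps) = cong suc (length-label (suc c) ps)

  taken-vacant : ∀ n → taken (vacant n) ≡ 0
  taken-vacant zero    = refl
  taken-vacant (suc n) = taken-vacant n

  taken≤length : ∀ o → taken o ≤ length o
  taken≤length []            = z≤n
  taken≤length (nothing ∷ o) = m≤n⇒m≤1+n (taken≤length o)
  taken≤length (just x ∷ o)  = s≤s (taken≤length o)

  taken-++ : ∀ o o′ → taken (o ++ o′) ≡ taken o + taken o′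
  taken-++ []      o′ = refl
  taken-++ (x ∷ o) o′ = trans (cong (occupied x +_) (taken-++ o o′)) (sym (+-assoc (occupied x) (taken o) (taken o′)))

  taken<length : ∀ o o′ → taken (o ++ nothing ∷ o′) < length (o ++ nothing ∷ o′)
  taken<length []            o′ = s≤s (taken≤length o′)
  taken<length (nothing ∷ o) o′ = m<n⇒m<1+n (taken<length o o′)
  taken<length (just x ∷ o)  o′ = s≤s (taken<length o o′)

  park-outcome : ∀ p c o → park p c o ≡ o ⊎ (taken (park p c o) ≡ suc (taken o) × just c ∈ park p c o)
  park-outcome p       c []            = inj₁ refl
  park-outcome zero    c (nothing ∷ o) = inj₂ (refl , here refl)
  park-outcome zero    c (just x ∷ o)  with park-outcome zero c o
  ... | inj₁ e        = inj₁ (cong (just x ∷_) e)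
  ... | inj₂ (e , c∈) = inj₂ (cong suc e , there c∈)
  park-outcome (suc p) c (x ∷ o)       with park-outcome p c o
  ... | inj₁ e        = inj₁ (cong (x ∷_) e)
  ... | inj₂ (e , c∈) = inj₂ (trans (cong (occupied x +_) e) (+-suc (occupied x) (taken o)) , there c∈)

  park-keeps-∈ : ∀ p c o {x} → just x ∈ o → just x ∈ park p c o
  park-keeps-∈ zero    c (nothing ∷ o) (there x∈) = there x∈
  park-keeps-∈ zero    c (just y ∷ o)  (here e)   = here e
  park-keeps-∈ zero    c (just y ∷ o)  (there x∈) = there (park-keeps-∈ zero c o x∈)
  park-keeps-∈ (suc p) c (y ∷ o)       (here e)   = here e
  park-keeps-∈ (suc p) c (y ∷ o)       (there x∈) = there (park-keeps-∈ p c o x∈)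

  parkCars-keeps-∈ : ∀ L o {x} → just x ∈ o → just x ∈ parkCars L o
  parkCars-keeps-∈ []            o x∈ = x∈
  parkCars-keeps-∈ ((c , p) ∷ L) o x∈ = parkCars-keeps-∈ L (park p c o) (park-keeps-∈ p c o x∈)

  park-keeps-spot : ∀ p c o i {x} → spot o i ≡ just x → spot (park p c o) i ≡ just x
  park-keeps-spot zero    c (nothing ∷ o) (suc i) e = e
  park-keeps-spot zero    c (just y ∷ o)  zero    e = e
  park-keeps-spot zero    c (just y ∷ o)  (suc i) e = park-keeps-spot zero c o i e
  park-keeps-spot (suc p) c (y ∷ o)       zero    e = e
  park-keeps-spot (suc p) c (y ∷ o)       (suc i) e = park-keeps-spot p c o i e

  parkCars-keeps-spot : ∀ L o i {x} → spot o i ≡ just x → spot (parkCars L o) i ≡ just x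
  parkCars-keeps-spot []            o i e = e
  parkCars-keeps-spot ((c , p) ∷ L) o i e = parkCars-keeps-spot L (park p c o) i (park-keeps-spot p c o i e)

  taken-parkCars≤ : ∀ L o → taken (parkCars L o) ≤ taken o + length L
  taken-parkCars≤ []            o = ≤-reflexive (sym (+-identityʳ (taken o)))
  taken-parkCars≤ ((c , p) ∷ L) o with park-outcome p c o
  ... | inj₁ e rewrite e = ≤-trans (taken-parkCars≤ L o) (+-monoʳ-≤ (taken o) (n≤1+n (length L)))
  ... | inj₂ (e , _)     = ≤-trans (taken-parkCars≤ L (park p c o))
                                   (≤-reflexive (trans (cong (_+ length L) e) (sym (+-suc (taken o) (length L)))))

  parkCars-places-all : ∀ L o → taken (parkCars L o) ≡ taken o + length L →
                        ∀ {c p} → (c , p) ∈ L → just c ∈ parkCars L o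
  parkCars-places-all ((c , p) ∷ L) o full with park-outcome p c o
  ... | inj₁ e rewrite e =
    ⊥-elim (<-irrefl refl (≤-trans (≤-reflexive (trans (sym (+-suc (taken o) (length L))) (sym full)))
                                   (taken-parkCars≤ L o)))
  ... | inj₂ (e , c∈) = λ { (here refl) → parkCars-keeps-∈ L (park p c o) c∈
                          ; (there cp∈) → parkCars-places-all L (park p c o) full′ cp∈ }
    where
    full′ : taken (parkCars L (park p c o)) ≡ taken (park p c o) + length L
    full′ = trans full (trans (+-suc (taken o) (length L)) (cong (_+ length L) (sym e)))

module FullStreet where

  open Street

  private
    swap-middle : ∀ a b c → a + (b + c) ≡ b + a + c
    swap-middle a b c = trans (sym (+-assoc a b c)) (cong (_+ c) (+-comm a b))

  park-free-spot : ∀ p c o s → spot (park p c o) s ≡ nothing → s < length o →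
                   spot o s ≡ nothing × taken (take s (park p c o)) ≡ indicator≤ p s + taken (take s o)
  park-free-spot zero    c (nothing ∷ o) (suc s) e _        = e , refl
  park-free-spot zero    c (just x ∷ o)  (suc s) e (s≤s s<) = Product.map₂ (cong suc) (park-free-spot zero c o s e s<)
  park-free-spot (suc p) c (x ∷ o)       zero    e _        = e , refl
  park-free-spot (suc p) c (nothing ∷ o) (suc s) e (s≤s s<) = park-free-spot p c o s e s<
  park-free-spot (suc p) c (just x ∷ o)  (suc s) e (s≤s s<) =
    Product.map₂ (λ eq → trans (cong suc eq) (sym (+-suc (indicator≤ p s) _))) (park-free-spot p c o s e s<)

  parkCars-free-spot : ∀ c ps o s → spot (parkCars (label c ps) o) s ≡ nothing → s < length o →
                       spot o s ≡ nothing × taken (take s (parkCars (label c ps) o)) ≡ countAtMost s ps + taken (take s o)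
  parkCars-free-spot c []       o s e s< = e , refl
  parkCars-free-spot c (p ∷ ps) o s e s<
    with free , count ← parkCars-free-spot (suc c) ps (park p c o) s e (subst (s <_) (sym (length-park p c o)) s<)
    with free′ , count′ ← park-free-spot p c o s free s<
    = free′ , trans count (trans (cong (countAtMost s ps +_) count′) (swap-middle (countAtMost s ps) (indicator≤ p s) _))

  park-taken-prefix : ∀ p c o i → taken (take (suc i) (park p c o)) ≤ indicator≤ p i + taken (take (suc i) o)
  park-taken-prefix p       c []            i       = z≤n
  park-taken-prefix zero    c (nothing ∷ o) i       = ≤-refl
  park-taken-prefix zero    c (just x ∷ o)  zero    = s≤s z≤n
  park-taken-prefix zero    c (just x ∷ o)  (suc i) = s≤s (park-taken-prefix zero c o i)
  park-taken-prefix (suc p) c (x ∷ o)       zero    = ≤-refl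
  park-taken-prefix (suc p) c (nothing ∷ o) (suc i) = park-taken-prefix p c o i
  park-taken-prefix (suc p) c (just x ∷ o)  (suc i) =
    ≤-trans (s≤s (park-taken-prefix p c o i)) (≤-reflexive (sym (+-suc (indicator≤ p i) _)))

  parkCars-taken-prefix : ∀ c ps o i → taken (take (suc i) (parkCars (label c ps) o)) ≤ countAtMost i ps + taken (take (suc i) o)
  parkCars-taken-prefix c []       o i = ≤-refl
  parkCars-taken-prefix c (p ∷ ps) o i = begin
    taken (take (suc i) (parkCars (label (suc c) ps) (park p c o)))  ≤⟨ parkCars-taken-prefix (suc c) ps (park p c o) i ⟩
    countAtMost i ps + taken (take (suc i) (park p c o))              ≤⟨ +-monoʳ-≤ (countAtMost i ps) (park-taken-prefix p c o i) ⟩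
    countAtMost i ps + (indicator≤ p i + taken (take (suc i) o))      ≡⟨ swap-middle (countAtMost i ps) (indicator≤ p i) _ ⟩
    countAtMost i (p ∷ ps) + taken (take (suc i) o)                   ∎
    where open ≤-Reasoning

  taken-take-vacant : ∀ s n → taken (take s (vacant n)) ≡ 0
  taken-take-vacant zero    n       = refl
  taken-take-vacant (suc s) zero    = refl
  taken-take-vacant (suc s) (suc n) = taken-take-vacant s n

  taken-take≤ : ∀ s o → taken (take s o) ≤ s
  taken-take≤ zero    o             = z≤n
  taken-take≤ (suc s) []            = z≤n
  taken-take≤ (suc s) (nothing ∷ o) = m≤n⇒m≤1+n (taken-take≤ s o)
  taken-take≤ (suc s) (just x ∷ o)  = s≤s (taken-take≤ s o)

  full-if-no-free-spot : ∀ o → (∀ s → s < length o → spot o s ≢ nothing) → taken o ≡ length o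
  full-if-no-free-spot []            _    = refl
  full-if-no-free-spot (nothing ∷ o) full = ⊥-elim (full 0 (s≤s z≤n) refl)
  full-if-no-free-spot (just x ∷ o)  full = cong suc (full-if-no-free-spot o (λ s s< → full (suc s) (s≤s s<)))

  taken-take-full : ∀ o k → taken o ≡ length o → k ≤ length o → taken (take k o) ≡ k
  taken-take-full o             zero    _    _         = refl
  taken-take-full (nothing ∷ o) (suc k) full _         = ⊥-elim (<-irrefl refl (≤-trans (≤-reflexive (sym full)) (taken≤length o)))
  taken-take-full (just x ∷ o)  (suc k) full (s≤s k≤) = cong suc (taken-take-full o k (suc-injective full) k≤)

  parking⇒full : ∀ n c ps → IsParkingList n ps → taken (parkCars (label c ps) (vacant n)) ≡ n
  parking⇒full n c ps parking =
    trans (full-if-no-free-spot F no-free-spot) (length-parkCars-vacant (label c ps) n)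
    where
    F = parkCars (label c ps) (vacant n)
    no-free-spot : ∀ s → s < length F → spot F s ≢ nothing
    no-free-spot s s<F free = <-irrefl refl (begin-strict
      s                                      <⟨ parking s s<n ⟩
      countAtMost s ps                       ≡⟨ sym (trans count (trans (cong (countAtMost s ps +_) (taken-take-vacant s n)) (+-identityʳ _))) ⟩
      taken (take s F)                       ≤⟨ taken-take≤ s F ⟩
      s                                      ∎)
      where
      open ≤-Reasoning
      s<n = subst (s <_) (length-parkCars-vacant (label c ps) n) s<F
      count = proj₂ (parkCars-free-spot c ps (vacant n) s free (subst (s <_) (sym (length-vacant n)) s<n))

  full⇒parking : ∀ n c ps → taken (parkCars (label c ps) (vacant n)) ≡ n → IsParkingList n ps
  full⇒parking n c ps full i i<n = begin
    suc i                                            ≡⟨ sym (taken-take-full F (suc i) (trans full (sym lengthF)) (subst (suc i ≤_) (sym lengthF) i<n)) ⟩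
    taken (take (suc i) F)                           ≤⟨ parkCars-taken-prefix c ps (vacant n) i ⟩
    countAtMost i ps + taken (take (suc i) (vacant n)) ≡⟨ trans (cong (countAtMost i ps +_) (taken-take-vacant (suc i) n)) (+-identityʳ _) ⟩
    countAtMost i ps                                 ∎
    where
    open ≤-Reasoning
    F = parkCars (label c ps) (vacant n)
    lengthF = length-parkCars-vacant (label c ps) n

module StreetSegments where

  open Street

  park-beyond : ∀ o q c o′ → park (length o + q) c (o ++ o′) ≡ o ++ park q c o′
  park-beyond []      q c o′ = refl
  park-beyond (x ∷ o) q c o′ = cong (x ∷_) (park-beyond o q c o′)

  park-right : ∀ o {p} c x o′ → length o < p → park p c (o ++ x ∷ o′) ≡ o ++ x ∷ park (p ∸ suc (length o)) c o′
  park-right []      c x o′ (s≤s _)  = refl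
  park-right (y ∷ o) c x o′ (s≤s o<) = cong (y ∷_) (park-right o c x o′ o<)

  park-here : ∀ o c o′ → park (length o) c (o ++ nothing ∷ o′) ≡ o ++ just c ∷ o′
  park-here []      c o′ = refl
  park-here (x ∷ o) c o′ = cong (x ∷_) (park-here o c o′)

  park-within : ∀ p c o o′ → p ≤ length o →
                (park p c (o ++ o′) ≡ park p c o ++ o′ × taken (park p c o) ≡ suc (taken o)) ⊎
                (park p c o ≡ o × park p c (o ++ o′) ≡ o ++ park 0 c o′)
  park-within zero    c []            o′ z≤n = inj₂ (refl , refl)
  park-within zero    c (nothing ∷ o) o′ _   = inj₁ (refl , refl)
  park-within zero    c (just x ∷ o)  o′ _   with park-within zero c o o′ z≤n
  ... | inj₁ (e , t) = inj₁ (cong (just x ∷_) e , cong suc t)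
  ... | inj₂ (e , f) = inj₂ (cong (just x ∷_) e , cong (just x ∷_) f)
  park-within (suc p) c (x ∷ o)       o′ (s≤s p≤) with park-within p c o o′ p≤
  ... | inj₁ (e , t) = inj₁ (cong (x ∷_) e , trans (cong (occupied x +_) t) (+-suc (occupied x) (taken o)))
  ... | inj₂ (e , f) = inj₂ (cong (x ∷_) e , cong (x ∷_) f)

  park-into-gap : ∀ a c o o′ → taken o ≡ length o → a ≤ length o → park a c (o ++ nothing ∷ o′) ≡ o ++ just c ∷ o′
  park-into-gap a c o o′ full a≤ with park-within a c o (nothing ∷ o′) a≤
  ... | inj₁ (_ , t) = ⊥-elim (<-irrefl refl (begin-strict
          length o            ≡⟨ sym full ⟩
          taken o             <⟨ ≤-reflexive (sym t) ⟩
          taken (park a c o)  ≤⟨ taken≤length (park a c o) ⟩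
          length (park a c o) ≡⟨ length-park a c o ⟩
          length o            ∎))
    where open ≤-Reasoning
  ... | inj₂ (_ , e) = e

  spot-middle : ∀ o x o′ → spot (o ++ x ∷ o′) (length o) ≡ x
  spot-middle []      x o′ = refl
  spot-middle (y ∷ o) x o′ = spot-middle o x o′

  parkCars-++ : ∀ L L′ o → parkCars (L ++ L′) o ≡ parkCars L′ (parkCars L o)
  parkCars-++ []            L′ o = refl
  parkCars-++ ((c , p) ∷ L) L′ o = parkCars-++ L L′ (park p c o)

  label-++ : ∀ c ps qs → label c (ps ++ qs) ≡ label c ps ++ label (c + length ps) qs
  label-++ c []       qs = cong (λ c′ → label c′ qs) (sym (+-identityʳ c))
  label-++ c (p ∷ ps) qs =
    cong ((c , p) ∷_) (trans (label-++ (suc c) ps qs) (cong (λ c′ → label (suc c) ps ++ label c′ qs) (sym (+-suc c (length ps)))))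

  parkCars-label-∷ʳ : ∀ c ps a o → parkCars (label c (ps ∷ʳ a)) o ≡ park a (c + length ps) (parkCars (label c ps) o)
  parkCars-label-∷ʳ c ps a o = trans (cong (λ L → parkCars L o) (label-++ c ps [ a ])) (parkCars-++ (label c ps) _ o)

  vacant-+ : ∀ a b → vacant (a + b) ≡ vacant a ++ vacant b
  vacant-+ zero    b = refl
  vacant-+ (suc a) b = cong (nothing ∷_) (vacant-+ a b)

  vacant-split : ∀ {s m} → s ≤ m → vacant (suc m) ≡ vacant s ++ nothing ∷ vacant (m ∸ s)
  vacant-split {s} {m} s≤m =
    trans (cong vacant (sym (trans (+-suc s (m ∸ s)) (cong suc (m+[n∸m]≡n s≤m))))) (vacant-+ s (suc (m ∸ s)))

  All-label : ∀ {P : ℕ → Set} c ps → All P ps → All (P ∘ proj₂) (label c ps)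
  All-label c []       []       = []
  All-label c (p ∷ ps) (q ∷ qs) = q ∷ All-label (suc c) ps qs

  label-All : ∀ {P : ℕ → Set} c ps → All (P ∘ proj₂) (label c ps) → All P ps
  label-All c []       []       = []
  label-All c (p ∷ ps) (q ∷ qs) = q ∷ label-All (suc c) ps qs

  parkCars-beyond : ∀ o o′ c ps → parkCars (label c (map (length o +_) ps)) (o ++ o′) ≡ o ++ parkCars (label c ps) o′
  parkCars-beyond o o′ c []       = refl
  parkCars-beyond o o′ c (q ∷ ps) =
    trans (cong (parkCars (label (suc c) (map (length o +_) ps))) (park-beyond o q c o′))
          (parkCars-beyond o (park q c o′) (suc c) ps)

  parkCars-within : ∀ L o o′ → All ((_≤ length o) ∘ proj₂) L → taken (parkCars L o) ≡ taken o + length L →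
                    parkCars L (o ++ o′) ≡ parkCars L o ++ o′
  parkCars-within []            o o′ _          _    = refl
  parkCars-within ((c , p) ∷ L) o o′ (p≤ ∷ ps≤) full with park-within p c o o′ p≤
  ... | inj₁ (e , t) rewrite e =
    parkCars-within L (park p c o) o′ (subst (λ k → All ((_≤ k) ∘ proj₂) L) (sym (length-park p c o)) ps≤)
                    (trans full (trans (+-suc (taken o) (length L)) (cong (_+ length L) (sym t))))
  ... | inj₂ (e , _) rewrite e =
    ⊥-elim (<-irrefl refl (≤-trans (≤-reflexive (trans (sym (+-suc (taken o) (length L))) (sym full))) (taken-parkCars≤ L o)))

module Gap where

  open Street
  open StreetSegments

  carsLeftOf : ℕ → List (ℕ × ℕ) → List (ℕ × ℕ)
  carsLeftOf s [] = []
  carsLeftOf s ((c , p) ∷ L) with <-cmp p s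
  ... | tri< _ _ _ = (c , p) ∷ carsLeftOf s L
  ... | tri≈ _ _ _ = carsLeftOf s L
  ... | tri> _ _ _ = carsLeftOf s L

  carsRightOf : ℕ → List (ℕ × ℕ) → List (ℕ × ℕ)
  carsRightOf s [] = []
  carsRightOf s ((c , p) ∷ L) with <-cmp p s
  ... | tri< _ _ _ = carsRightOf s L
  ... | tri≈ _ _ _ = carsRightOf s L
  ... | tri> _ _ _ = (c , p ∸ suc s) ∷ carsRightOf s L

  taken-middle-stays-taken : ∀ L o c o′ → spot (parkCars L (o ++ just c ∷ o′)) (length o) ≢ nothing
  taken-middle-stays-taken L o c o′ free
    with () ← trans (sym free) (parkCars-keeps-spot L _ (length o) (spot-middle o (just c) o′))

  parkCars-split : ∀ s L o o′ → length o ≡ s → spot (parkCars L (o ++ nothing ∷ o′)) s ≡ nothing →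
                   All ((_≢ s) ∘ proj₂) L ×
                   parkCars L (o ++ nothing ∷ o′) ≡ parkCars (carsLeftOf s L) o ++ nothing ∷ parkCars (carsRightOf s L) o′
  parkCars-split s []            o o′ _    _    = [] , refl
  parkCars-split s ((c , p) ∷ L) o o′ refl free with <-cmp p (length o)
  ... | tri< p<s _ _ with park-within p c o (nothing ∷ o′) (<⇒≤ p<s)
  ...   | inj₁ (e , _) rewrite e =
    Product.map₁ ((λ p≡s → <-irrefl p≡s p<s) ∷_) (parkCars-split (length o) L (park p c o) o′ (length-park p c o) free)
  ...   | inj₂ (_ , e) rewrite e = ⊥-elim (taken-middle-stays-taken L o c o′ free)
  parkCars-split s ((c , p) ∷ L) o o′ refl free | tri≈ _ refl _ rewrite park-here o c o′ = ⊥-elim (taken-middle-stays-taken L o c o′ free)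
  parkCars-split s ((c , p) ∷ L) o o′ refl free | tri> _ _ s<p rewrite park-right o c nothing o′ s<p =
    Product.map₁ ((λ p≡s → <-irrefl (sym p≡s) s<p) ∷_) (parkCars-split (length o) L o (park (p ∸ suc (length o)) c o′) refl free)

  length-carsLeftOf+carsRightOf : ∀ s L → All ((_≢ s) ∘ proj₂) L →
                                  length (carsLeftOf s L) + length (carsRightOf s L) ≡ length L
  length-carsLeftOf+carsRightOf s []            []          = refl
  length-carsLeftOf+carsRightOf s ((c , p) ∷ L) (p≢s ∷ ps≢) with <-cmp p s
  ... | tri< _ _ _   = cong suc (length-carsLeftOf+carsRightOf s L ps≢)
  ... | tri≈ _ p≡s _ = ⊥-elim (p≢s p≡s)
  ... | tri> _ _ _   = trans (+-suc (length (carsLeftOf s L)) _) (cong suc (length-carsLeftOf+carsRightOf s L ps≢))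

  ∈-carsLeftOf : ∀ s L {c p} → (c , p) ∈ L → p < s → (c , p) ∈ carsLeftOf s L
  ∈-carsLeftOf s ((c′ , p′) ∷ L) cp∈ p<s with <-cmp p′ s | cp∈
  ... | tri< _ _ _    | here refl = here refl
  ... | tri≈ p≮s _ _  | here refl = ⊥-elim (p≮s p<s)
  ... | tri> p≮s _ _  | here refl = ⊥-elim (p≮s p<s)
  ... | tri< _ _ _    | there cp∈ = there (∈-carsLeftOf s L cp∈ p<s)
  ... | tri≈ _ _ _    | there cp∈ = ∈-carsLeftOf s L cp∈ p<s
  ... | tri> _ _ _    | there cp∈ = ∈-carsLeftOf s L cp∈ p<s

  ∈-carsRightOf : ∀ s L {c p} → (c , p) ∈ L → s < p → (c , p ∸ suc s) ∈ carsRightOf s L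
  ∈-carsRightOf s ((c′ , p′) ∷ L) cp∈ s<p with <-cmp p′ s | cp∈
  ... | tri< _ _ s≮p  | here refl = ⊥-elim (s≮p s<p)
  ... | tri≈ _ _ s≮p  | here refl = ⊥-elim (s≮p s<p)
  ... | tri> _ _ _    | here refl = here refl
  ... | tri< _ _ _    | there cp∈ = ∈-carsRightOf s L cp∈ s<p
  ... | tri≈ _ _ _    | there cp∈ = ∈-carsRightOf s L cp∈ s<p
  ... | tri> _ _ _    | there cp∈ = there (∈-carsRightOf s L cp∈ s<p)

  carsLeftOf-++ : ∀ s L L′ → carsLeftOf s (L ++ L′) ≡ carsLeftOf s L ++ carsLeftOf s L′
  carsLeftOf-++ s []            L′ = refl
  carsLeftOf-++ s ((c , p) ∷ L) L′ with <-cmp p s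
  ... | tri< _ _ _ = cong ((c , p) ∷_) (carsLeftOf-++ s L L′)
  ... | tri≈ _ _ _ = carsLeftOf-++ s L L′
  ... | tri> _ _ _ = carsLeftOf-++ s L L′

  carsRightOf-++ : ∀ s L L′ → carsRightOf s (L ++ L′) ≡ carsRightOf s L ++ carsRightOf s L′
  carsRightOf-++ s []            L′ = refl
  carsRightOf-++ s ((c , p) ∷ L) L′ with <-cmp p s
  ... | tri< _ _ _ = carsRightOf-++ s L L′
  ... | tri≈ _ _ _ = carsRightOf-++ s L L′
  ... | tri> _ _ _ = cong ((c , p ∸ suc s) ∷_) (carsRightOf-++ s L L′)

  carsLeftOf-label-< : ∀ s c ps → All (_< s) ps → carsLeftOf s (label c ps) ≡ label c ps
  carsLeftOf-label-< s c []       []          = refl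
  carsLeftOf-label-< s c (p ∷ ps) (p<s ∷ ps<) with <-cmp p s
  ... | tri< _ _ _   = cong ((c , p) ∷_) (carsLeftOf-label-< s (suc c) ps ps<)
  ... | tri≈ _ p≡s _ = ⊥-elim (<-irrefl p≡s p<s)
  ... | tri> _ _ s<p = ⊥-elim (<-asym s<p p<s)

  carsLeftOf-label-> : ∀ s c ps → All (s <_) ps → carsLeftOf s (label c ps) ≡ []
  carsLeftOf-label-> s c []       []          = refl
  carsLeftOf-label-> s c (p ∷ ps) (s<p ∷ ps>) with <-cmp p s
  ... | tri< p<s _ _ = ⊥-elim (<-asym p<s s<p)
  ... | tri≈ _ p≡s _ = ⊥-elim (<-irrefl (sym p≡s) s<p)
  ... | tri> _ _ _   = carsLeftOf-label-> s (suc c) ps ps>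

  carsRightOf-label-< : ∀ s c ps → All (_< s) ps → carsRightOf s (label c ps) ≡ []
  carsRightOf-label-< s c []       []          = refl
  carsRightOf-label-< s c (p ∷ ps) (p<s ∷ ps<) with <-cmp p s
  ... | tri< _ _ _   = carsRightOf-label-< s (suc c) ps ps<
  ... | tri≈ _ p≡s _ = ⊥-elim (<-irrefl p≡s p<s)
  ... | tri> _ _ s<p = ⊥-elim (<-asym s<p p<s)

  carsRightOf-label-> : ∀ s c ps → All (s <_) ps → carsRightOf s (label c ps) ≡ label c (map (_∸ suc s) ps)
  carsRightOf-label-> s c []       []          = refl
  carsRightOf-label-> s c (p ∷ ps) (s<p ∷ ps>) with <-cmp p s
  ... | tri< p<s _ _ = ⊥-elim (<-asym p<s s<p)
  ... | tri≈ _ p≡s _ = ⊥-elim (<-irrefl (sym p≡s) s<p)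
  ... | tri> _ _ _   = cong ((c , p ∸ suc s) ∷_) (carsRightOf-label-> s (suc c) ps ps>)

  carsLeftOf-right-then-left : ∀ s c A B → All (s <_) A → All (_< s) B → carsLeftOf s (label c (A ++ B)) ≡ label (c + length A) B
  carsLeftOf-right-then-left s c A B A>s B<s =
    trans (cong (carsLeftOf s) (label-++ c A B))
          (trans (carsLeftOf-++ s (label c A) _) (cong₂ _++_ (carsLeftOf-label-> s c A A>s) (carsLeftOf-label-< s _ B B<s)))

  carsRightOf-right-then-left : ∀ s c A B → All (s <_) A → All (_< s) B → carsRightOf s (label c (A ++ B)) ≡ label c (map (_∸ suc s) A)
  carsRightOf-right-then-left s c A B A>s B<s =
    trans (cong (carsRightOf s) (label-++ c A B))
          (trans (carsRightOf-++ s (label c A) _)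
                 (trans (cong₂ _++_ (carsRightOf-label-> s c A A>s) (carsRightOf-label-< s _ B B<s)) (++-identityʳ _)))

  carsLeftOf-left-then-right : ∀ s c A B → All (_< s) A → All (s <_) B → carsLeftOf s (label c (A ++ B)) ≡ label c A
  carsLeftOf-left-then-right s c A B A<s B>s =
    trans (cong (carsLeftOf s) (label-++ c A B))
          (trans (carsLeftOf-++ s (label c A) _)
                 (trans (cong₂ _++_ (carsLeftOf-label-< s c A A<s) (carsLeftOf-label-> s _ B B>s)) (++-identityʳ _)))

  carsRightOf-left-then-right : ∀ s c A B → All (_< s) A → All (s <_) B →
                                carsRightOf s (label c (A ++ B)) ≡ label (c + length A) (map (_∸ suc s) B)
  carsRightOf-left-then-right s c A B A<s B>s =
    trans (cong (carsRightOf s) (label-++ c A B))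
          (trans (carsRightOf-++ s (label c A) _) (cong₂ _++_ (carsRightOf-label-< s c A A<s) (carsRightOf-label-> s _ B B>s)))

module Patterns where

  nth : List ℕ → ℕ → ℕ
  nth []      i       = 0
  nth (x ∷ π) zero    = x
  nth (x ∷ π) (suc i) = nth π i

  record Occurs (R : ℕ → ℕ → ℕ → Set) (π : List ℕ) : Set where
    constructor occurrence
    field
      i j k : ℕ
      i<j   : i < j
      j<k   : j < k
      k<    : k < length π
      holds : R (nth π i) (nth π j) (nth π k)

  Is132 : ℕ → ℕ → ℕ → Set
  Is132 a b c = a < c × c < b

  Is231 : ℕ → ℕ → ℕ → Set
  Is231 a b c = c < a × a < b

  shift-Is132 : ∀ d {a b c} → Is132 a b c → Is132 (d + a) (d + b) (d + c)
  shift-Is132 d (a<c , c<b) = +-monoʳ-< d a<c , +-monoʳ-< d c<b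

  unshift-Is132 : ∀ d {a b c} → Is132 (d + a) (d + b) (d + c) → Is132 a b c
  unshift-Is132 d (a<c , c<b) = +-cancelˡ-< d _ _ a<c , +-cancelˡ-< d _ _ c<b

  shift-Is231 : ∀ d {a b c} → Is231 a b c → Is231 (d + a) (d + b) (d + c)
  shift-Is231 d (c<a , a<b) = +-monoʳ-< d c<a , +-monoʳ-< d a<b

  unshift-Is231 : ∀ d {a b c} → Is231 (d + a) (d + b) (d + c) → Is231 a b c
  unshift-Is231 d (c<a , a<b) = +-cancelˡ-< d _ _ c<a , +-cancelˡ-< d _ _ a<b

  private
    subst₃ : ∀ (R : ℕ → ℕ → ℕ → Set) {a a′ b b′ c c′} → a ≡ a′ → b ≡ b′ → c ≡ c′ → R a b c → R a′ b′ c′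
    subst₃ R refl refl refl r = r

  nth-++ˡ : ∀ π π′ {i} → i < length π → nth (π ++ π′) i ≡ nth π i
  nth-++ˡ (x ∷ π) π′ {zero}  _        = refl
  nth-++ˡ (x ∷ π) π′ {suc i} (s≤s i<) = nth-++ˡ π π′ i<

  nth-++ʳ : ∀ π π′ i → nth (π ++ π′) (length π + i) ≡ nth π′ i
  nth-++ʳ []      π′ i = refl
  nth-++ʳ (x ∷ π) π′ i = nth-++ʳ π π′ i

  nth-middle : ∀ π x π′ → nth (π ++ x ∷ π′) (length π) ≡ x
  nth-middle []      x π′ = refl
  nth-middle (y ∷ π) x π′ = nth-middle π x π′

  nth-map : ∀ f π {i} → i < length π → nth (map f π) i ≡ f (nth π i)
  nth-map f (x ∷ π) {zero}  _        = refl
  nth-map f (x ∷ π) {suc i} (s≤s i<) = nth-map f π i<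

  nth-All : ∀ {P : ℕ → Set} π {i} → All P π → i < length π → P (nth π i)
  nth-All (x ∷ π) {zero}  (p ∷ _)  _        = p
  nth-All (x ∷ π) {suc i} (_ ∷ ps) (s≤s i<) = nth-All π ps i<

  All-nth : ∀ {P : ℕ → Set} π → (∀ i → i < length π → P (nth π i)) → All P π
  All-nth []      _  = []
  All-nth (x ∷ π) ps = ps 0 (s≤s z≤n) ∷ All-nth π (λ i i< → ps (suc i) (s≤s i<))

  Occurs-++ˡ : ∀ {R} π π′ → Occurs R π → Occurs R (π ++ π′)
  Occurs-++ˡ {R} π π′ (occurrence i j k i<j j<k k< r) =
    occurrence i j k i<j j<k (<-≤-trans k< (≤-trans (m≤m+n (length π) (length π′)) (≤-reflexive (sym (length-++ π)))))
      (subst₃ R (sym (nth-++ˡ π π′ (<-trans (<-trans i<j j<k) k<))) (sym (nth-++ˡ π π′ (<-trans j<k k<))) (sym (nth-++ˡ π π′ k<)) r)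

  Occurs-++ʳ : ∀ {R} π π′ → Occurs R π′ → Occurs R (π ++ π′)
  Occurs-++ʳ {R} π π′ (occurrence i j k i<j j<k k< r) =
    occurrence (length π + i) (length π + j) (length π + k) (+-monoʳ-< (length π) i<j) (+-monoʳ-< (length π) j<k)
      (<-≤-trans (+-monoʳ-< (length π) k<) (≤-reflexive (sym (length-++ π))))
      (subst₃ R (sym (nth-++ʳ π π′ i)) (sym (nth-++ʳ π π′ j)) (sym (nth-++ʳ π π′ k)) r)

  Occurs-map⁺ : ∀ {R} f π → (∀ {a b c} → R a b c → R (f a) (f b) (f c)) → Occurs R π → Occurs R (map f π)
  Occurs-map⁺ {R} f π f-preserves (occurrence i j k i<j j<k k< r) =
    occurrence i j k i<j j<k (subst (k <_) (sym (length-map f π)) k<)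
      (subst₃ R (sym (nth-map f π (<-trans (<-trans i<j j<k) k<))) (sym (nth-map f π (<-trans j<k k<))) (sym (nth-map f π k<))
        (f-preserves r))

  Occurs-map⁻ : ∀ {R} f π → (∀ {a b c} → R (f a) (f b) (f c) → R a b c) → Occurs R (map f π) → Occurs R π
  Occurs-map⁻ {R} f π f-reflects (occurrence i j k i<j j<k k<′ r) =
    occurrence i j k i<j j<k k<
      (f-reflects (subst₃ R (nth-map f π (<-trans (<-trans i<j j<k) k<)) (nth-map f π (<-trans j<k k<)) (nth-map f π k<) r))
    where
    k< : k < length π
    k< = subst (k <_) (length-map f π) k<′

  Occurs-across : ∀ {R} π x π′ {u v} → u < length π → v < length π′ → R (nth π u) x (nth π′ v) → Occurs R (π ++ x ∷ π′)
  Occurs-across {R} π x π′ {u} {v} u< v< r =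
    occurrence u (length π) (length π + suc v) u< (≤-trans (s≤s (m≤m+n (length π) v)) (≤-reflexive (sym (+-suc (length π) v))))
      (subst (length π + suc v <_) (sym (length-++ π)) (+-monoʳ-< (length π) (s≤s v<)))
      (subst₃ R (sym (nth-++ˡ π (x ∷ π′) u<)) (sym (nth-middle π x π′)) (sym (nth-++ʳ π (x ∷ π′) (suc v))) r)

  data Position (π : List ℕ) (x : ℕ) (π′ : List ℕ) : ℕ → Set where
    left   : ∀ {t} → t < length π → Position π x π′ t
    middle : Position π x π′ (length π)
    right  : ∀ t′ → t′ < length π′ → Position π x π′ (length π + suc t′)

  data Beyond (π π′ : List ℕ) : ℕ → Set where
    beyond : ∀ t′ → t′ < length π′ → Beyond π π′ (length π + suc t′)

  beyond-middle : ∀ π x π′ {t} → length π < t → t < length (π ++ x ∷ π′) → Beyond π π′ t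
  beyond-middle π x π′ {t} π<t t< = subst (Beyond π π′) t≡ (beyond t′ t′<)
    where
    t′ = t ∸ suc (length π)
    t≡ : length π + suc t′ ≡ t
    t≡ = trans (+-suc (length π) t′) (m+[n∸m]≡n π<t)
    t′< : t′ < length π′
    t′< = ≤-pred (+-cancelˡ-< (length π) _ _ (subst₂ _<_ (sym t≡) (length-++ π) t<))

  position : ∀ π x π′ t → t < length (π ++ x ∷ π′) → Position π x π′ t
  position π x π′ t t< with <-cmp t (length π)
  ... | tri< t<π _ _  = left t<π
  ... | tri≈ _ refl _ = middle
  ... | tri> _ _ π<t  with beyond-middle π x π′ π<t t<
  ...   | beyond t′ t′< = right t′ t′<

  private
    π<right : ∀ (π : List ℕ) t → length π < length π + suc t
    π<right π t = ≤-<-trans (m≤m+n (length π) t) (+-monoʳ-< (length π) ≤-refl)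

    cancel-right : ∀ (π : List ℕ) {t u} → length π + suc t < length π + suc u → t < u
    cancel-right π lt = ≤-pred (+-cancelˡ-< (length π) _ _ lt)

    nth-left : ∀ π x π′ {t} → t < length π → nth (π ++ x ∷ π′) t ≡ nth π t
    nth-left π x π′ = nth-++ˡ π (x ∷ π′)

    nth-right : ∀ π x π′ t → nth (π ++ x ∷ π′) (length π + suc t) ≡ nth π′ t
    nth-right π x π′ t = nth-++ʳ π (x ∷ π′) (suc t)

  join132 : ∀ π x π′ → All (λ a → All (_< a) π′) π → All (_< x) π → All (_< x) π′ →
            ¬ Occurs Is132 π → ¬ Occurs Is132 π′ → ¬ Occurs Is132 (π ++ x ∷ π′)
  join132 π x π′ π′<π π<x π′<x ∌π ∌π′ (occurrence i j k i<j j<k k< (i<k , k<j)) with position π x π′ k k<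
  ... | left k<π = ∌π (occurrence i j k i<j j<k k<π
          (subst₂ _<_ (nth-left π x π′ (<-trans (<-trans i<j j<k) k<π)) (nth-left π x π′ k<π) i<k ,
           subst₂ _<_ (nth-left π x π′ k<π) (nth-left π x π′ (<-trans j<k k<π)) k<j))
  ... | middle = <-asym (nth-All π π<x j<k) (subst₂ _<_ (nth-middle π x π′) (nth-left π x π′ j<k) k<j)
  ... | right k′ k′< with position π x π′ i (<-trans (<-trans i<j j<k) k<)
  ...   | left i<π = <-asym (nth-All π′ (nth-All π π′<π i<π) k′<) (subst₂ _<_ (nth-left π x π′ i<π) (nth-right π x π′ k′) i<k)
  ...   | middle   = <-asym (nth-All π′ π′<x k′<) (subst₂ _<_ (nth-middle π x π′) (nth-right π x π′ k′) i<k)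
  ...   | right i′ i′< with beyond-middle π x π′ (<-trans (π<right π i′) i<j) (<-trans j<k k<)
  ...     | beyond j′ j′< = ∌π′ (occurrence i′ j′ k′ (cancel-right π i<j) (cancel-right π j<k) k′<
                              (subst₂ _<_ (nth-right π x π′ i′) (nth-right π x π′ k′) i<k ,
                               subst₂ _<_ (nth-right π x π′ k′) (nth-right π x π′ j′) k<j))

  join231 : ∀ π x π′ → All (λ a → All (a <_) π′) π → All (_< x) π → All (_< x) π′ →
            ¬ Occurs Is231 π → ¬ Occurs Is231 π′ → ¬ Occurs Is231 (π ++ x ∷ π′)
  join231 π x π′ π<π′ π<x π′<x ∌π ∌π′ (occurrence i j k i<j j<k k< (k<i , i<j′)) with position π x π′ k k<
  ... | left k<π = ∌π (occurrence i j k i<j j<k k<π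
          (subst₂ _<_ (nth-left π x π′ k<π) (nth-left π x π′ (<-trans (<-trans i<j j<k) k<π)) k<i ,
           subst₂ _<_ (nth-left π x π′ (<-trans (<-trans i<j j<k) k<π)) (nth-left π x π′ (<-trans j<k k<π)) i<j′))
  ... | middle = <-asym (nth-All π π<x (<-trans i<j j<k)) (subst₂ _<_ (nth-middle π x π′) (nth-left π x π′ (<-trans i<j j<k)) k<i)
  ... | right k′ k′< with position π x π′ i (<-trans (<-trans i<j j<k) k<)
  ...   | left i<π = <-asym (nth-All π′ (nth-All π π<π′ i<π) k′<) (subst₂ _<_ (nth-right π x π′ k′) (nth-left π x π′ i<π) k<i)
  ...   | middle with beyond-middle π x π′ i<j (<-trans j<k k<)
  ...     | beyond j′ j′< = <-asym (nth-All π′ π′<x j′<) (subst₂ _<_ (nth-middle π x π′) (nth-right π x π′ j′) i<j′)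
  join231 π x π′ π<π′ π<x π′<x ∌π ∌π′ (occurrence i j k i<j j<k k< (k<i , i<j′))
    | right k′ k′< | right i′ i′< with beyond-middle π x π′ (<-trans (π<right π i′) i<j) (<-trans j<k k<)
  ...     | beyond j′ j′< = ∌π′ (occurrence i′ j′ k′ (cancel-right π i<j) (cancel-right π j<k) k′<
                              (subst₂ _<_ (nth-right π x π′ k′) (nth-right π x π′ i′) k<i ,
                               subst₂ _<_ (nth-right π x π′ i′) (nth-right π x π′ j′) i<j′))

module Labels where

  open Street

  InRange : ℕ → ℕ → ℕ → Set
  InRange lo hi x = lo ≤ x × x < hi

  park-preserves-All : ∀ {P : ℕ → Set} p c o → P c → All (Maybe.All P) o → All (Maybe.All P) (park p c o)
  park-preserves-All p       c []            pc []       = []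
  park-preserves-All zero    c (nothing ∷ o) pc (_ ∷ qs) = just pc ∷ qs
  park-preserves-All zero    c (just x ∷ o)  pc (q ∷ qs) = q ∷ park-preserves-All zero c o pc qs
  park-preserves-All (suc p) c (x ∷ o)       pc (q ∷ qs) = q ∷ park-preserves-All p c o pc qs

  parkCars-labels-in-range : ∀ lo hi c ps o → All (Maybe.All (InRange lo hi)) o → lo ≤ c → c + length ps ≤ hi →
                             All (Maybe.All (InRange lo hi)) (parkCars (label c ps) o)
  parkCars-labels-in-range lo hi c []       o qs lo≤c _ = qs
  parkCars-labels-in-range lo hi c (p ∷ ps) o qs lo≤c c+ps≤hi =
    parkCars-labels-in-range lo hi (suc c) ps (park p c o)
      (park-preserves-All p c o (lo≤c , <-≤-trans (s≤s (m≤m+n c (length ps))) c+ps≤hi′) qs) (m≤n⇒m≤1+n lo≤c) c+ps≤hi′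
    where
    c+ps≤hi′ : suc c + length ps ≤ hi
    c+ps≤hi′ = ≤-trans (≤-reflexive (sym (+-suc c (length ps)))) c+ps≤hi

  vacant-labels : ∀ {P : ℕ → Set} n → All (Maybe.All P) (vacant n)
  vacant-labels n = All.replicate⁺ n nothing

  -- A free spot reads as the junk label 0.
  readOff : Street → List ℕ
  readOff = map (fromMaybe 0)

  readOff-All : ∀ {P : ℕ → Set} o → All (Maybe.All P) o → taken o ≡ length o → All P (readOff o)
  readOff-All []            []            _    = []
  readOff-All (nothing ∷ o) _             full = ⊥-elim (<-irrefl refl (≤-trans (≤-reflexive (sym full)) (taken≤length o)))
  readOff-All (just x ∷ o)  (just px ∷ qs) full = px ∷ readOff-All o qs (suc-injective full)

  readOff-map : ∀ f o → taken o ≡ length o → readOff (map (mapMaybe f) o) ≡ map f (readOff o)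
  readOff-map f []            _    = refl
  readOff-map f (nothing ∷ o) full = ⊥-elim (<-irrefl refl (≤-trans (≤-reflexive (sym full)) (taken≤length o)))
  readOff-map f (just x ∷ o)  full = cong (f x ∷_) (readOff-map f o (suc-injective full))

  park-map : ∀ f p c o → park p (f c) (map (mapMaybe f) o) ≡ map (mapMaybe f) (park p c o)
  park-map f p       c []            = refl
  park-map f zero    c (nothing ∷ o) = refl
  park-map f zero    c (just x ∷ o)  = cong (just (f x) ∷_) (park-map f zero c o)
  park-map f (suc p) c (x ∷ o)       = cong (mapMaybe f x ∷_) (park-map f p c o)

  parkCars-shift : ∀ d c ps o → parkCars (label (d + c) ps) (map (mapMaybe (d +_)) o) ≡ map (mapMaybe (d +_)) (parkCars (label c ps) o)
  parkCars-shift d c []       o = refl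
  parkCars-shift d c (p ∷ ps) o =
    trans (cong (parkCars (label (suc (d + c)) ps)) (park-map (d +_) p c o))
          (trans (cong (λ c′ → parkCars (label c′ ps) (map (mapMaybe (d +_)) (park p c o))) (sym (+-suc d c)))
                 (parkCars-shift d (suc c) ps (park p c o)))

  ∈-readOff : ∀ o {x} → just x ∈ o → ∃ λ i → i < length (readOff o) × Patterns.nth (readOff o) i ≡ x
  ∈-readOff (y ∷ o) (here refl) = 0 , s≤s z≤n , refl
  ∈-readOff (y ∷ o) (there x∈) with i , i< , e ← ∈-readOff o x∈ = suc i , s≤s i< , e

  labels-below : ∀ lo hi n o → hi ≤ n → All (Maybe.All (InRange lo hi)) o → All (_≢ just n) o
  labels-below lo hi n []            hi≤n []                    = []
  labels-below lo hi n (nothing ∷ o) hi≤n (_ ∷ qs)              = (λ ()) ∷ labels-below lo hi n o hi≤n qs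
  labels-below lo hi n (just x ∷ o)  hi≤n (just (_ , x<hi) ∷ qs) =
    (λ { refl → <-irrefl refl (<-≤-trans x<hi hi≤n) }) ∷ labels-below lo hi n o hi≤n qs

module ParkingWords where

  open Street
  open FullStreet
  open Labels

  parkingWord : ℕ → List ℕ → List ℕ
  parkingWord n ps = readOff (parkCars (label 1 ps) (vacant n))

  PkList : (ℕ → ℕ → ℕ → Set) → ℕ → List ℕ → Set
  PkList R n ps = length ps ≡ n × All (_< n) ps × IsParkingList n ps × ¬ Patterns.Occurs R (parkingWord n ps)

  length-parkingWord : ∀ n ps → length (parkingWord n ps) ≡ n
  length-parkingWord n ps = trans (length-map (fromMaybe 0) (parkCars (label 1 ps) (vacant n))) (length-parkCars-vacant (label 1 ps) n)

  full-street : ∀ n c ps → IsParkingList n ps → taken (parkCars (label c ps) (vacant n)) ≡ length (parkCars (label c ps) (vacant n))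
  full-street n c ps parking = trans (parking⇒full n c ps parking) (sym (length-parkCars-vacant (label c ps) n))

  readOff-shift : ∀ d n ps → IsParkingList n ps → readOff (parkCars (label (suc d) ps) (vacant n)) ≡ map (d +_) (parkingWord n ps)
  readOff-shift d n ps parking = begin
    readOff (parkCars (label (suc d) ps) (vacant n))
      ≡⟨ cong₂ (λ c o → readOff (parkCars (label c ps) o)) (+-comm 1 d) (sym (map-replicate (mapMaybe (d +_)) n nothing)) ⟩
    readOff (parkCars (label (d + 1) ps) (map (mapMaybe (d +_)) (vacant n)))
      ≡⟨ cong readOff (parkCars-shift d 1 ps (vacant n)) ⟩
    readOff (map (mapMaybe (d +_)) (parkCars (label 1 ps) (vacant n)))
      ≡⟨ readOff-map (d +_) _ (full-street n 1 ps parking) ⟩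
    map (d +_) (parkingWord n ps) ∎
    where open ≡-Reasoning

  readOff-in-range : ∀ n c ps hi → IsParkingList n ps → c + length ps ≤ hi →
                     All (InRange c hi) (readOff (parkCars (label c ps) (vacant n)))
  readOff-in-range n c ps hi parking ≤hi =
    readOff-All _ (parkCars-labels-in-range c hi c ps (vacant n) (vacant-labels n) ≤-refl ≤hi) (full-street n c ps parking)

module Assembly where

  open Street
  open FullStreet
  open StreetSegments
  open ParkingWords using (PkList)

  parkCars-left-of-gap : ∀ c s ps o → length ps ≡ s → All (_< s) ps → IsParkingList s ps →
                         parkCars (label c ps) (vacant s ++ nothing ∷ o) ≡ parkCars (label c ps) (vacant s) ++ nothing ∷ o
  parkCars-left-of-gap c s ps o length≡ ps<s parking =
    parkCars-within (label c ps) (vacant s) (nothing ∷ o)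
      (All-label c ps (All.map (λ p<s → ≤-trans (<⇒≤ p<s) (≤-reflexive (sym (length-vacant s)))) ps<s))
      (trans (parking⇒full s c ps parking) (sym (cong₂ _+_ (taken-vacant s) (trans (length-label c ps) length≡))))

  parkCars-right-of-gap : ∀ c o o′ ps → parkCars (label c (map (suc (length o) +_) ps)) (o ++ nothing ∷ o′) ≡
                                         o ++ nothing ∷ parkCars (label c ps) o′
  parkCars-right-of-gap c o o′ ps = begin
    parkCars (label c (map (suc (length o) +_) ps)) (o ++ nothing ∷ o′)
      ≡⟨ cong₂ (λ k o″ → parkCars (label c (map (k +_) ps)) o″) length-o∷ʳ (sym (++-assoc o [ nothing ] o′)) ⟩
    parkCars (label c (map (length (o ∷ʳ nothing) +_) ps)) ((o ∷ʳ nothing) ++ o′)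
      ≡⟨ parkCars-beyond (o ∷ʳ nothing) o′ c ps ⟩
    (o ∷ʳ nothing) ++ parkCars (label c ps) o′
      ≡⟨ ++-assoc o [ nothing ] _ ⟩
    o ++ nothing ∷ parkCars (label c ps) o′ ∎
    where
    open ≡-Reasoning
    length-o∷ʳ : suc (length o) ≡ length (o ∷ʳ nothing)
    length-o∷ʳ = sym (trans (length-++ o) (+-comm (length o) 1))

  -- The preference of the last car, and the preference lists of the cars parking
  -- left and right of it (the latter counted from the spot after it).
  Pieces : Set
  Pieces = ℕ × List ℕ × List ℕ

  assemble132 : ℕ → Pieces → List ℕ
  assemble132 s (a , g , h) = map (suc s +_) h ++ g ++ [ a ]

  assemble231 : ℕ → Pieces → List ℕ
  assemble231 s (a , g , h) = g ++ map (suc s +_) h ++ [ a ]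

  ValidPieces : (ℕ → ℕ → ℕ → Set) → ℕ → ℕ → Pieces → Set
  ValidPieces R m s (a , g , h) = a < suc s × PkList R s g × PkList R (m ∸ s) h

  AssembledFrom : (ℕ → ℕ → ℕ → Set) → (ℕ → Pieces → List ℕ) → ℕ → ℕ → List ℕ → Set
  AssembledFrom R assemble m s ps = ∃ λ t → ValidPieces R m s t × ps ≡ assemble s t

  module _ {s m a : ℕ} {g h : List ℕ} (s≤m : s ≤ m) (a≤s : a ≤ s) (length-g : length g ≡ s) (g<s : All (_< s) g)
           (g-parking : IsParkingList s g) (length-h : length h ≡ m ∸ s) where

    private
      j = m ∸ s

      full-left : ∀ c → taken (parkCars (label c g) (vacant s)) ≡ length (parkCars (label c g) (vacant s))
      full-left c = trans (parking⇒full s c g g-parking) (sym (length-parkCars-vacant (label c g) s))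

      last≤ : ∀ c → a ≤ length (parkCars (label c g) (vacant s))
      last≤ c = ≤-trans a≤s (≤-reflexive (sym (length-parkCars-vacant (label c g) s)))

      label-shifted : ∀ c → label c (map (suc s +_) h) ≡ label c (map (suc (length (vacant s)) +_) h)
      label-shifted c = cong (λ k → label c (map (suc k +_) h)) (sym (length-vacant s))

      length-shifted : length (map (suc s +_) h) ≡ j
      length-shifted = trans (length-map _ h) length-h

    parkCars-assemble132 : parkCars (label 1 (assemble132 s (a , g , h))) (vacant (suc m)) ≡
                           parkCars (label (suc j) g) (vacant s) ++ just (suc m) ∷ parkCars (label 1 h) (vacant j)
    parkCars-assemble132 = begin
      parkCars (label 1 (H ++ g ++ [ a ])) (vacant (suc m))
        ≡⟨ cong₂ parkCars (label-++ 1 H (g ++ [ a ])) (vacant-split s≤m) ⟩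
      parkCars (label 1 H ++ label (1 + length H) (g ++ [ a ])) (vacant s ++ nothing ∷ vacant j)
        ≡⟨ parkCars-++ (label 1 H) _ _ ⟩
      parkCars (label (suc (length H)) (g ++ [ a ])) (parkCars (label 1 H) (vacant s ++ nothing ∷ vacant j))
        ≡⟨ cong₂ (λ k o → parkCars (label (suc k) (g ++ [ a ])) o) length-shifted
                 (trans (cong (λ L → parkCars L (vacant s ++ nothing ∷ vacant j)) (label-shifted 1)) (parkCars-right-of-gap 1 (vacant s) (vacant j) h)) ⟩
      parkCars (label (suc j) (g ++ [ a ])) (vacant s ++ nothing ∷ Hp)
        ≡⟨ parkCars-label-∷ʳ (suc j) g a _ ⟩
      park a (suc j + length g) (parkCars (label (suc j) g) (vacant s ++ nothing ∷ Hp))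
        ≡⟨ cong (park a _) (parkCars-left-of-gap (suc j) s g Hp length-g g<s g-parking) ⟩
      park a (suc j + length g) (Gp ++ nothing ∷ Hp)
        ≡⟨ park-into-gap a _ Gp Hp (full-left (suc j)) (last≤ (suc j)) ⟩
      Gp ++ just (suc j + length g) ∷ Hp
        ≡⟨ cong (λ k → Gp ++ just (suc k) ∷ Hp) (trans (cong (j +_) length-g) (trans (+-comm j s) (m+[n∸m]≡n s≤m))) ⟩
      Gp ++ just (suc m) ∷ Hp ∎
      where
      open ≡-Reasoning
      H  = map (suc s +_) h
      Gp = parkCars (label (suc j) g) (vacant s)
      Hp = parkCars (label 1 h) (vacant j)

    parkCars-assemble231 : parkCars (label 1 (assemble231 s (a , g , h))) (vacant (suc m)) ≡
                           parkCars (label 1 g) (vacant s) ++ just (suc m) ∷ parkCars (label (suc s) h) (vacant j)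
    parkCars-assemble231 = begin
      parkCars (label 1 (g ++ H ++ [ a ])) (vacant (suc m))
        ≡⟨ cong₂ parkCars (label-++ 1 g (H ++ [ a ])) (vacant-split s≤m) ⟩
      parkCars (label 1 g ++ label (1 + length g) (H ++ [ a ])) (vacant s ++ nothing ∷ vacant j)
        ≡⟨ parkCars-++ (label 1 g) _ _ ⟩
      parkCars (label (suc (length g)) (H ++ [ a ])) (parkCars (label 1 g) (vacant s ++ nothing ∷ vacant j))
        ≡⟨ cong₂ (λ k o → parkCars (label (suc k) (H ++ [ a ])) o) length-g (parkCars-left-of-gap 1 s g (vacant j) length-g g<s g-parking) ⟩
      parkCars (label (suc s) (H ++ [ a ])) (Gp ++ nothing ∷ vacant j)
        ≡⟨ parkCars-label-∷ʳ (suc s) H a _ ⟩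
      park a (suc s + length H) (parkCars (label (suc s) H) (Gp ++ nothing ∷ vacant j))
        ≡⟨ cong (park a _) (trans (cong (λ k → parkCars (label (suc s) (map (suc k +_) h)) (Gp ++ nothing ∷ vacant j)) (sym (length-parkCars-vacant (label 1 g) s)))
                                  (parkCars-right-of-gap (suc s) Gp (vacant j) h)) ⟩
      park a (suc s + length H) (Gp ++ nothing ∷ Hp)
        ≡⟨ park-into-gap a _ Gp Hp (full-left 1) (last≤ 1) ⟩
      Gp ++ just (suc s + length H) ∷ Hp
        ≡⟨ cong (λ k → Gp ++ just (suc k) ∷ Hp) (trans (cong (s +_) length-shifted) (m+[n∸m]≡n s≤m)) ⟩
      Gp ++ just (suc m) ∷ Hp ∎
      where
      open ≡-Reasoning
      H  = map (suc s +_) h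
      Gp = parkCars (label 1 g) (vacant s)
      Hp = parkCars (label (suc s) h) (vacant j)

module Soundness where

  open Street
  open FullStreet
  open Labels
  open ParkingWords
  open Patterns
  open Assembly

  length-++-∷ʳ : ∀ (xs ys : List ℕ) a → length (xs ++ ys ∷ʳ a) ≡ suc (length xs + length ys)
  length-++-∷ʳ xs ys a = trans (length-++ xs) (trans (cong (length xs +_) (trans (length-++ ys) (+-comm (length ys) 1))) (+-suc (length xs) (length ys)))

  module _ {m s : ℕ} (s≤m : s ≤ m) where

    private
      j = m ∸ s

      s+j≡m : s + j ≡ m
      s+j≡m = m+[n∸m]≡n s≤m

      shifted< : ∀ {x} → x < j → suc s + x < suc m
      shifted< x<j = <-≤-trans (+-monoʳ-< (suc s) x<j) (≤-reflexive (cong suc s+j≡m))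

      taken-middle : ∀ Gp Hp → taken Gp ≡ s → taken Hp ≡ j → taken (Gp ++ just (suc m) ∷ Hp) ≡ suc m
      taken-middle Gp Hp tG tH =
        trans (taken-++ Gp (just (suc m) ∷ Hp)) (trans (cong₂ (λ x y → x + suc y) tG tH) (trans (+-suc s j) (cong suc s+j≡m)))

      word-middle : ∀ ps Gp Hp → parkCars (label 1 ps) (vacant (suc m)) ≡ Gp ++ just (suc m) ∷ Hp →
                    parkingWord (suc m) ps ≡ readOff Gp ++ suc m ∷ readOff Hp
      word-middle ps Gp Hp e = trans (cong readOff e) (map-++ (fromMaybe 0) Gp (just (suc m) ∷ Hp))

    sound132 : ∀ {ps} → AssembledFrom Is132 assemble132 m s ps → PkList Is132 (suc m) ps
    sound132 ((a , g , h) , (a<1+s , (length-g , g<s , g-parking , g-avoids) , (length-h , h<j , h-parking , h-avoids)) , refl) =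
      trans (length-++-∷ʳ H g a) (cong suc (trans (cong₂ _+_ (trans (length-map _ h) length-h) length-g) (trans (+-comm j s) s+j≡m))) ,
      All.++⁺ (All.map⁺ (All.map shifted< h<j)) (All.++⁺ (All.map (λ x<s → <-trans x<s (s≤s s≤m)) g<s) (≤-trans a<1+s (s≤s s≤m) ∷ [])) ,
      full⇒parking (suc m) 1 (assemble132 s (a , g , h)) full ,
      λ occ → join132 (readOff Gp) (suc m) (readOff Hp)
                (All.map (λ x∈G → All.map (λ y∈H → <-≤-trans (proj₂ y∈H) (proj₁ x∈G)) H-range) G-range)
                (All.map proj₂ G-range)
                (All.map (λ y∈H → <-≤-trans (proj₂ y∈H) (s≤s (m∸n≤m m s))) H-range)
                (λ occ′ → g-avoids (Occurs-map⁻ (j +_) (parkingWord s g) (unshift-Is132 j)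
                                     (subst (Occurs Is132) (readOff-shift j s g g-parking) occ′)))
                h-avoids
                (subst (Occurs Is132) (word-middle (assemble132 s (a , g , h)) Gp Hp street) occ)
      where
      H  = map (suc s +_) h
      Gp = parkCars (label (suc j) g) (vacant s)
      Hp = parkCars (label 1 h) (vacant j)
      street = parkCars-assemble132 {h = h} s≤m (≤-pred a<1+s) length-g g<s g-parking length-h
      full = trans (cong taken street) (taken-middle Gp Hp (parking⇒full s (suc j) g g-parking) (parking⇒full j 1 h h-parking))
      G-range : All (InRange (suc j) (suc m)) (readOff Gp)
      G-range = readOff-in-range s (suc j) g (suc m) g-parking (≤-reflexive (cong suc (trans (cong (j +_) length-g) (trans (+-comm j s) s+j≡m))))
      H-range : All (InRange 1 (suc j)) (readOff Hp)
      H-range = readOff-in-range j 1 h (suc j) h-parking (≤-reflexive (cong suc length-h))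

    sound231 : ∀ {ps} → AssembledFrom Is231 assemble231 m s ps → PkList Is231 (suc m) ps
    sound231 ((a , g , h) , (a<1+s , (length-g , g<s , g-parking , g-avoids) , (length-h , h<j , h-parking , h-avoids)) , refl) =
      trans (length-++-∷ʳ g H a) (cong suc (trans (cong₂ _+_ length-g (trans (length-map _ h) length-h)) s+j≡m)) ,
      All.++⁺ (All.map (λ x<s → <-trans x<s (s≤s s≤m)) g<s) (All.++⁺ (All.map⁺ (All.map shifted< h<j)) (≤-trans a<1+s (s≤s s≤m) ∷ [])) ,
      full⇒parking (suc m) 1 (assemble231 s (a , g , h)) full ,
      λ occ → join231 (readOff Gp) (suc m) (readOff Hp)
                (All.map (λ x∈G → All.map (λ y∈H → <-≤-trans (proj₂ x∈G) (proj₁ y∈H)) H-range) G-range)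
                (All.map (λ x∈G → <-≤-trans (proj₂ x∈G) (s≤s s≤m)) G-range)
                (All.map proj₂ H-range)
                g-avoids
                (λ occ′ → h-avoids (Occurs-map⁻ (s +_) (parkingWord j h) (unshift-Is231 s)
                                     (subst (Occurs Is231) (readOff-shift s j h h-parking) occ′)))
                (subst (Occurs Is231) (word-middle (assemble231 s (a , g , h)) Gp Hp street) occ)
      where
      H  = map (suc s +_) h
      Gp = parkCars (label 1 g) (vacant s)
      Hp = parkCars (label (suc s) h) (vacant j)
      street = parkCars-assemble231 {h = h} s≤m (≤-pred a<1+s) length-g g<s g-parking length-h
      full = trans (cong taken street) (taken-middle Gp Hp (parking⇒full s 1 g g-parking) (parking⇒full j (suc s) h h-parking))
      G-range : All (InRange 1 (suc s)) (readOff Gp)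
      G-range = readOff-in-range s 1 g (suc s) g-parking (≤-reflexive (cong suc length-g))
      H-range : All (InRange (suc s) (suc m)) (readOff Hp)
      H-range = readOff-in-range j (suc s) h (suc m) h-parking (≤-reflexive (cong suc (trans (cong (s +_) length-h) s+j≡m)))

module Decomposition where

  open Street
  open FullStreet
  open StreetSegments
  open Gap

  free-spot : ∀ o → taken o < length o → ∃ λ o₁ → ∃ λ o₂ → o ≡ o₁ ++ nothing ∷ o₂
  free-spot (nothing ∷ o) _        = [] , o , refl
  free-spot (just x ∷ o)  (s≤s t<) with o₁ , o₂ , e ← free-spot o t< = just x ∷ o₁ , o₂ , cong (just x ∷_) e

  full-no-free-spot : ∀ o o₁ o₂ → taken o ≡ length o → o ≢ o₁ ++ nothing ∷ o₂
  full-no-free-spot o o₁ o₂ full refl = <-irrefl full (taken<length o₁ o₂)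

  park-fills-gap : ∀ a c o o′ → taken (park a c (o ++ nothing ∷ o′)) ≡ length (park a c (o ++ nothing ∷ o′)) →
                   a ≤ length o × park a c (o ++ nothing ∷ o′) ≡ o ++ just c ∷ o′
  park-fills-gap a c o o′ full with <-cmp (length o) a
  ... | tri< o<a _ _ = ⊥-elim (full-no-free-spot _ o _ full (park-right o c nothing o′ o<a))
  ... | tri≈ _ refl _ = ≤-refl , park-here o c o′
  ... | tri> _ _ a<o with park-within a c o (nothing ∷ o′) (<⇒≤ a<o)
  ...   | inj₁ (e , _) = ⊥-elim (full-no-free-spot _ (park a c o) o′ full e)
  ...   | inj₂ (_ , e) = <⇒≤ a<o , e

  both-≡ : ∀ {x y s t} → x ≤ s → y ≤ t → x + y ≡ s + t → x ≡ s × y ≡ t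
  both-≡ {x} {y} {s} {t} x≤s y≤t e =
    ≤-antisym x≤s (+-cancelʳ-≤ t s x (≤-trans (≤-reflexive (sym e)) (+-monoʳ-≤ x y≤t))) ,
    ≤-antisym y≤t (+-cancelˡ-≤ s t y (≤-trans (≤-reflexive (sym e)) (+-monoˡ-≤ y x≤s)))

  taken-sides : ∀ {s m x} Lp Rp → length Lp ≡ s → length Rp ≡ m ∸ s → s ≤ m →
                taken (Lp ++ just x ∷ Rp) ≡ suc m → taken Lp ≡ s × taken Rp ≡ m ∸ s
  taken-sides {s} {m} {x} Lp Rp length-Lp length-Rp s≤m full =
    both-≡ (≤-trans (taken≤length Lp) (≤-reflexive length-Lp)) (≤-trans (taken≤length Rp) (≤-reflexive length-Rp))
           (suc-injective (begin
             suc (taken Lp + taken Rp)       ≡⟨ sym (+-suc (taken Lp) (taken Rp)) ⟩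
             taken Lp + suc (taken Rp)       ≡⟨ sym (taken-++ Lp (just x ∷ Rp)) ⟩
             taken (Lp ++ just x ∷ Rp)       ≡⟨ full ⟩
             suc m                           ≡⟨ cong suc (sym (m+[n∸m]≡n s≤m)) ⟩
             suc (s + (m ∸ s))               ∎))
    where open ≡-Reasoning

  lengths-of-sides : ∀ {s t} L R → taken (parkCars L (vacant s)) ≡ s → taken (parkCars R (vacant t)) ≡ t →
                 length L + length R ≡ s + t → length L ≡ s × length R ≡ t
  lengths-of-sides {s} {t} L R full-L full-R total = Product.map sym sym (both-≡ (enough L full-L) (enough R full-R) (sym total))
    where
    enough : ∀ {n} L → taken (parkCars L (vacant n)) ≡ n → n ≤ length L
    enough {n} L full = begin
      n                                ≡⟨ sym full ⟩
      taken (parkCars L (vacant n))    ≤⟨ taken-parkCars≤ L (vacant n) ⟩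
      taken (vacant n) + length L      ≡⟨ cong (_+ length L) (taken-vacant n) ⟩
      length L                         ∎
      where open ≤-Reasoning

  length-left-of-middle : ∀ {m} (o₁ : Street) {x} o₂ → length (o₁ ++ x ∷ o₂) ≡ suc m → length o₁ ≤ m
  length-left-of-middle o₁ o₂ length≡ =
    ≤-pred (≤-trans (s≤s (m≤m+n (length o₁) (length o₂))) (≤-reflexive (trans (sym (trans (length-++ o₁) (+-suc _ _))) length≡)))

  parked : ∀ L {n} → taken (parkCars L (vacant n)) ≡ n → length L ≡ n → ∀ {c p} → (c , p) ∈ L → just c ∈ parkCars L (vacant n)
  parked L {n} full length≡ = parkCars-places-all L (vacant n) (trans full (sym (trans (cong (_+ length L) (taken-vacant n)) length≡)))

  ∈-label : ∀ c ps {i} → i < length ps → (c + i , Patterns.nth ps i) ∈ label c ps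
  ∈-label c (p ∷ ps) {zero}  _        = here (cong (_, p) (+-identityʳ c))
  ∈-label c (p ∷ ps) {suc i} (s≤s i<) =
    there (subst (λ c′ → (c′ , Patterns.nth ps i) ∈ label (suc c) ps) (sym (+-suc c i)) (∈-label (suc c) ps i<))

  leftStreet : ℕ → List ℕ → Street
  leftStreet s init = parkCars (carsLeftOf s (label 1 init)) (vacant s)

  rightStreet : ℕ → ℕ → List ℕ → Street
  rightStreet m s init = parkCars (carsRightOf s (label 1 init)) (vacant (m ∸ s))

  -- The last car takes the spot gap left free by the others, which splits them into
  -- two independent parking processes.
  record LastCar (m : ℕ) (ps : List ℕ) : Set where
    field
      gap          : ℕ
      init         : List ℕ
      last         : ℕ
      gap≤m        : gap ≤ m
      last≤gap     : last ≤ gap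
      ps≡          : ps ≡ init ∷ʳ last
      length-init  : length init ≡ m
      init≢gap     : All (_≢ gap) init
      street       : parkCars (label 1 ps) (vacant (suc m)) ≡ leftStreet gap init ++ just (suc m) ∷ rightStreet m gap init
      left-full    : taken (leftStreet gap init) ≡ gap
      right-full   : taken (rightStreet m gap init) ≡ m ∸ gap
      length-left  : length (carsLeftOf gap (label 1 init)) ≡ gap
      length-right : length (carsRightOf gap (label 1 init)) ≡ m ∸ gap
      left-parked  : ∀ i → i < length init → Patterns.nth init i < gap → just (suc i) ∈ leftStreet gap init
      right-parked : ∀ i → i < length init → gap < Patterns.nth init i → just (suc i) ∈ rightStreet m gap init

  private
    vacancy-before-last : ∀ m init → length init ≡ m →
                          taken (parkCars (label 1 init) (vacant (suc m))) < length (parkCars (label 1 init) (vacant (suc m)))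
    vacancy-before-last m init length-init = begin-strict
      taken (parkCars (label 1 init) (vacant (suc m)))  ≤⟨ taken-parkCars≤ (label 1 init) (vacant (suc m)) ⟩
      taken (vacant (suc m)) + length (label 1 init)   ≡⟨ cong₂ _+_ (taken-vacant (suc m)) (trans (length-label 1 init) length-init) ⟩
      m                                                <⟨ ≤-refl ⟩
      suc m                                            ≡⟨ sym (length-parkCars-vacant (label 1 init) (suc m)) ⟩
      length (parkCars (label 1 init) (vacant (suc m))) ∎
      where open ≤-Reasoning

    lastCar′ : ∀ m init last → length init ≡ m → IsParkingList (suc m) (init ∷ʳ last) → LastCar m (init ∷ʳ last)
    lastCar′ m init last length-init parking
      with o₁ , o₂ , before≡ ← free-spot (parkCars (label 1 init) (vacant (suc m))) (vacancy-before-last m init length-init)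
      = record
        { gap = s ; init = init ; last = last ; gap≤m = s≤m ; last≤gap = ≤-trans (proj₁ last-parks) (≤-reflexive length-Lp) ; ps≡ = refl
        ; length-init = length-init ; init≢gap = label-All 1 init (proj₁ split) ; street = street
        ; left-full = proj₁ full-sides ; right-full = proj₂ full-sides
        ; length-left = proj₁ lengths ; length-right = proj₂ lengths
        ; left-parked = λ i i< p<s → parked Left (proj₁ full-sides) (proj₁ lengths) (∈-carsLeftOf s (label 1 init) (∈-label 1 init i<) p<s)
        ; right-parked = λ i i< s<p → parked Right (proj₂ full-sides) (proj₂ lengths) (∈-carsRightOf s (label 1 init) (∈-label 1 init i<) s<p)
        }
      where
      s = length o₁
      s≤m : s ≤ m
      s≤m = length-left-of-middle o₁ o₂ (trans (cong length (sym before≡)) (length-parkCars-vacant (label 1 init) (suc m)))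
      Left  = carsLeftOf s (label 1 init)
      Right = carsRightOf s (label 1 init)
      Lp = leftStreet s init
      Rp = rightStreet m s init
      split = parkCars-split s (label 1 init) (vacant s) (vacant (m ∸ s)) (length-vacant s)
                (subst (λ o → spot (parkCars (label 1 init) o) s ≡ nothing) (vacant-split s≤m)
                       (trans (cong (λ o → spot o s) before≡) (spot-middle o₁ nothing o₂)))
      after≡ : parkCars (label 1 (init ∷ʳ last)) (vacant (suc m)) ≡ park last (suc m) (Lp ++ nothing ∷ Rp)
      after≡ = trans (parkCars-label-∷ʳ 1 init last _)
                     (cong₂ (λ c o → park last (suc c) o) length-init (trans (cong (parkCars (label 1 init)) (vacant-split s≤m)) (proj₂ split)))
      full-after : taken (parkCars (label 1 (init ∷ʳ last)) (vacant (suc m))) ≡ suc m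
      full-after = parking⇒full (suc m) 1 (init ∷ʳ last) parking
      last-parks = park-fills-gap last (suc m) Lp Rp
                     (subst (λ o → taken o ≡ length o) after≡ (trans full-after (sym (length-parkCars-vacant (label 1 (init ∷ʳ last)) (suc m)))))
      length-Lp : length Lp ≡ s
      length-Lp = length-parkCars-vacant Left s
      street : parkCars (label 1 (init ∷ʳ last)) (vacant (suc m)) ≡ Lp ++ just (suc m) ∷ Rp
      street = trans after≡ (proj₂ last-parks)
      full-sides : taken Lp ≡ s × taken Rp ≡ m ∸ s
      full-sides = taken-sides Lp Rp length-Lp (length-parkCars-vacant Right (m ∸ s)) s≤m (trans (cong taken (sym street)) full-after)
      lengths : length Left ≡ s × length Right ≡ m ∸ s
      lengths = lengths-of-sides Left Right (proj₁ full-sides) (proj₂ full-sides)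
        (trans (length-carsLeftOf+carsRightOf s (label 1 init) (proj₁ split)) (trans (trans (length-label 1 init) length-init) (sym (m+[n∸m]≡n s≤m))))

  lastCar : ∀ m ps → length ps ≡ suc m → IsParkingList (suc m) ps → LastCar m ps
  lastCar m ps length-ps parking with initLast ps
  ... | init ∷ʳ′ last = lastCar′ m init last (suc-injective (trans (sym (+-comm (length init) 1)) (trans (sym (length-++ init)) length-ps))) parking

module Completeness where

  open Street
  open FullStreet
  open Gap
  open Labels
  open Patterns
  open ParkingWords
  open Assembly
  open Decomposition

  record Separated (P Q : ℕ → Set) (l : List ℕ) : Set where
    field
      front back : List ℕ
      l≡         : l ≡ front ++ back
      All-front  : All Q front
      All-back   : All P back

  separated-split : ∀ (P Q : ℕ → Set) l → All (λ x → P x ⊎ Q x) l →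
                    (∀ i k → i < k → k < length l → P (nth l i) → ¬ Q (nth l k)) → Separated P Q l
  separated-split P Q []      _               _   = record { front = [] ; back = [] ; l≡ = refl ; All-front = [] ; All-back = [] }
  separated-split P Q (x ∷ l) (inj₁ px ∷ pqs) sep =
    record { front = [] ; back = x ∷ l ; l≡ = refl ; All-front = [] ; All-back = px ∷ All-nth l only-P }
    where
    only-P : ∀ k → k < length l → P (nth l k)
    only-P k k< with nth-All l pqs k<
    ... | inj₁ p = p
    ... | inj₂ q = ⊥-elim (sep 0 (suc k) (s≤s z≤n) (s≤s k<) px q)
  separated-split P Q (x ∷ l) (inj₂ qx ∷ pqs) sep =
    record { front = x ∷ front ; back = back ; l≡ = cong (x ∷_) l≡ ; All-front = qx ∷ All-front ; All-back = All-back }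
    where open Separated (separated-split P Q l pqs (λ i k i<k k< → sep (suc i) (suc k) (s≤s i<k) (s≤s k<)))

  <⊎> : ∀ {x s} → x ≢ s → x < s ⊎ s < x
  <⊎> {x} {s} x≢s with <-cmp x s
  ... | tri< x<s _ _ = inj₁ x<s
  ... | tri≈ _ x≡s _ = ⊥-elim (x≢s x≡s)
  ... | tri> _ _ s<x = inj₂ s<x

  unshift : ∀ s xs → All (s <_) xs → map (suc s +_) (map (_∸ suc s) xs) ≡ xs
  unshift s xs s<xs = trans (sym (map-∘ xs)) (map-id-local (All.map m+[n∸m]≡n s<xs))

  unshift< : ∀ {m s x} → s < x → x < suc m → x ∸ suc s < m ∸ s
  unshift< {m} {s} s<x x<1+m = ≤-trans (≤-reflexive (sym (+-∸-assoc 1 s<x))) (∸-monoˡ-≤ s (≤-pred x<1+m))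

  decompose : ∀ {R m ps} → PkList R (suc m) ps → LastCar m ps
  decompose {m = m} {ps} (length-ps , _ , parking , _) = lastCar m ps length-ps parking

  module _ {R : ℕ → ℕ → ℕ → Set} {m : ℕ} {ps : List ℕ} (pk : PkList R (suc m) ps) where

    open LastCar (decompose pk)

    private
      s = gap
      Lp = leftStreet gap init
      Rp = rightStreet m gap init

      word≡ : parkingWord (suc m) ps ≡ readOff Lp ++ suc m ∷ readOff Rp
      word≡ = trans (cong readOff street) (map-++ (fromMaybe 0) Lp (just (suc m) ∷ Rp))

    avoids-split : ¬ Occurs R (readOff Lp ++ suc m ∷ readOff Rp)
    avoids-split = proj₂ (proj₂ (proj₂ pk)) ∘ subst (Occurs R) (sym word≡)

    -- Cars u+1 (left of the gap) and v+1 (right of it) would form the triple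
    -- u+1, m+1, v+1 around the last car.
    no-crossing : ∀ {u v} → u < length init → v < length init → nth init u < s → s < nth init v → ¬ R (suc u) (suc m) (suc v)
    no-crossing {u} {v} u< v< u-left v-right r
      with i , i< , eu ← ∈-readOff Lp (left-parked u u< u-left)
      with k , k< , ev ← ∈-readOff Rp (right-parked v v< v-right)
      = avoids-split (Occurs-across (readOff Lp) (suc m) (readOff Rp) i< k< (subst₂ (λ x y → R x (suc m) y) (sym eu) (sym ev) r))

    left-avoids : ¬ Occurs R (readOff Lp)
    left-avoids = avoids-split ∘ Occurs-++ˡ (readOff Lp) (suc m ∷ readOff Rp)

    right-avoids : ¬ Occurs R (readOff Rp)
    right-avoids = avoids-split ∘ Occurs-++ʳ (readOff Lp) (suc m ∷ readOff Rp) ∘ Occurs-++ʳ [ suc m ] (readOff Rp)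

    left-PkList : (∀ d {a b c} → R a b c → R (d + a) (d + b) (d + c)) →
                  ∀ d g → carsLeftOf s (label 1 init) ≡ label (suc d) g → All (_< s) g → PkList R s g
    left-PkList shift d g e g<s = length-g , g<s , g-parking , λ occ →
      left-avoids (subst (Occurs R) (trans (sym (readOff-shift d s g g-parking)) (cong (λ L → readOff (parkCars L (vacant s))) (sym e)))
                         (Occurs-map⁺ (d +_) (parkingWord s g) (shift d) occ))
      where
      length-g = trans (sym (length-label (suc d) g)) (trans (cong length (sym e)) length-left)
      g-parking = full⇒parking s (suc d) g (trans (cong (λ L → taken (parkCars L (vacant s))) (sym e)) left-full)

    right-PkList : (∀ d {a b c} → R a b c → R (d + a) (d + b) (d + c)) →
                   ∀ d h → carsRightOf s (label 1 init) ≡ label (suc d) h → All (_< m ∸ s) h → PkList R (m ∸ s) h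
    right-PkList shift d h e h<j = length-h , h<j , h-parking , λ occ →
      right-avoids (subst (Occurs R) (trans (sym (readOff-shift d (m ∸ s) h h-parking)) (cong (λ L → readOff (parkCars L (vacant (m ∸ s)))) (sym e)))
                          (Occurs-map⁺ (d +_) (parkingWord (m ∸ s) h) (shift d) occ))
      where
      length-h = trans (sym (length-label (suc d) h)) (trans (cong length (sym e)) length-right)
      h-parking = full⇒parking (m ∸ s) (suc d) h (trans (cong (λ L → taken (parkCars L (vacant (m ∸ s)))) (sym e)) right-full)

    private
      prefs<1+m : All (_< suc m) init
      prefs<1+m = All.++⁻ˡ init (subst (All (_< suc m)) ps≡ (proj₁ (proj₂ pk)))

      unshift-bounds : ∀ {A} → All (s <_) A → All (_< suc m) A → All (_< m ∸ s) (map (_∸ suc s) A)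
      unshift-bounds A>s A<1+m = All.map⁺ (All.zipWith (λ (s<x , x<) → unshift< s<x x<) (A>s , A<1+m))

    either-side : All (λ x → x < s ⊎ s < x) init
    either-side = All.map <⊎> init≢gap

    module _ (shift : ∀ d {a b c} → R a b c → R (d + a) (d + b) (d + c)) (A B : List ℕ) (init≡ : init ≡ A ++ B) where

      right-then-left : All (s <_) A → All (_< s) B → PkList R s B × PkList R (m ∸ s) (map (_∸ suc s) A)
      right-then-left A>s B<s =
        left-PkList shift (length A) B (trans (cong (λ l → carsLeftOf s (label 1 l)) init≡) (carsLeftOf-right-then-left s 1 A B A>s B<s)) B<s ,
        right-PkList shift 0 _ (trans (cong (λ l → carsRightOf s (label 1 l)) init≡) (carsRightOf-right-then-left s 1 A B A>s B<s))
          (unshift-bounds A>s (All.++⁻ˡ A (subst (All (_< suc m)) init≡ prefs<1+m)))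

      left-then-right : All (_< s) A → All (s <_) B → PkList R s A × PkList R (m ∸ s) (map (_∸ suc s) B)
      left-then-right A<s B>s =
        pk-A ,
        right-PkList shift s _ (trans (cong (λ l → carsRightOf s (label 1 l)) init≡)
                                      (trans (carsRightOf-left-then-right s 1 A B A<s B>s) (cong (λ k → label (suc k) _) (proj₁ pk-A))))
          (unshift-bounds B>s (All.++⁻ʳ A (subst (All (_< suc m)) init≡ prefs<1+m)))
        where
        pk-A = left-PkList shift 0 A (trans (cong (λ l → carsLeftOf s (label 1 l)) init≡) (carsLeftOf-left-then-right s 1 A B A<s B>s)) A<s

  complete132 : ∀ m ps → PkList Is132 (suc m) ps → ∃ λ s → s ≤ m × AssembledFrom Is132 assemble132 m s ps
  complete132 m ps pk = gap , gap≤m , (last , back , map (_∸ suc gap) front) , (s≤s last≤gap , pk-pieces) , ps≡assembled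
    where
    open LastCar (decompose pk)
    later-cars-left : ∀ i k → i < k → k < length init → nth init i < gap → ¬ gap < nth init k
    later-cars-left i k i<k k< i-left k-right =
      no-crossing pk (<-trans i<k k<) k< i-left k-right (s≤s i<k , s≤s (<-≤-trans k< (≤-reflexive length-init)))
    open Separated (separated-split (_< gap) (gap <_) init (either-side pk) later-cars-left)
    pk-pieces = right-then-left pk shift-Is132 front back l≡ All-front All-back
    ps≡assembled : ps ≡ assemble132 gap (last , back , map (_∸ suc gap) front)
    ps≡assembled = trans ps≡ (trans (cong (_∷ʳ last) l≡)
                                    (trans (++-assoc front back [ last ]) (cong (_++ back ++ [ last ]) (sym (unshift gap front All-front)))))

  complete231 : ∀ m ps → PkList Is231 (suc m) ps → ∃ λ s → s ≤ m × AssembledFrom Is231 assemble231 m s ps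
  complete231 m ps pk = gap , gap≤m , (last , front , map (_∸ suc gap) back) , (s≤s last≤gap , pk-pieces) , ps≡assembled
    where
    open LastCar (decompose pk)
    earlier-cars-left : ∀ i k → i < k → k < length init → gap < nth init i → ¬ nth init k < gap
    earlier-cars-left i k i<k k< i-right k-left =
      no-crossing pk k< (<-trans i<k k<) k-left i-right (s≤s i<k , s≤s (<-≤-trans k< (≤-reflexive length-init)))
    open Separated (separated-split (gap <_) (_< gap) init (All.map Sum.swap (either-side pk)) earlier-cars-left)
    pk-pieces = left-then-right pk shift-Is231 front back l≡ All-front All-back
    ps≡assembled : ps ≡ assemble231 gap (last , front , map (_∸ suc gap) back)
    ps≡assembled = trans ps≡ (trans (cong (_∷ʳ last) l≡)
                                    (trans (++-assoc front back [ last ]) (cong (λ B → front ++ B ++ [ last ]) (sym (unshift gap back All-back)))))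

module Counting
  (R : ℕ → ℕ → ℕ → Set) (assemble : ℕ → Assembly.Pieces → List ℕ)
  (sound : ∀ {m s} → s ≤ m → ∀ {ps} → Assembly.AssembledFrom R assemble m s ps → ParkingWords.PkList R (suc m) ps)
  (complete : ∀ m ps → ParkingWords.PkList R (suc m) ps → ∃ λ s → s ≤ m × Assembly.AssembledFrom R assemble m s ps)
  (disjoint : ∀ {m s s′ ps} → s ≤ m → s′ ≤ m →
              Assembly.AssembledFrom R assemble m s ps → Assembly.AssembledFrom R assemble m s′ ps → s ≡ s′)
  (injective : ∀ {m s t t′} → Assembly.ValidPieces R m s t → Assembly.ValidPieces R m s t′ → assemble s t ≡ assemble s t′ → t ≡ t′)
  where

  open ParkingWords
  open Assembly
  open Cardinality

  PkList-0 : HasCard (PkList R 0) 1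
  PkList-0 = [ [] ] , [] ∷ [] , (λ ps → (λ { (here refl) → refl , [] , (λ _ ()) , λ () }) , λ { (length≡ , _) → here (empty length≡) }) , refl
    where
    empty : ∀ {ps : List ℕ} → length ps ≡ 0 → ps ≡ []
    empty {[]} _ = refl

  module _ (c : ℕ → ℕ) (m : ℕ) (IH : ∀ n → n ≤ m → HasCard (PkList R n) (c n)) where

    private
      F : ℕ → ℕ
      F k = k * c (k ∸ 1) * c (suc m ∸ k)

      AssembledBelow : ℕ → List ℕ → Set
      AssembledBelow K ps = ∃ λ s → s < K × AssembledFrom R assemble m s ps

    AssembledFrom-card : ∀ s → s ≤ m → HasCard (AssembledFrom R assemble m s) (F (suc s))
    AssembledFrom-card s s≤m =
      subst (HasCard _) (sym (*-assoc (suc s) (c s) (c (m ∸ s))))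
        (HasCard-image (assemble s) injective (HasCard-× (HasCard-< (suc s)) (HasCard-× (IH s s≤m) (IH (m ∸ s) (m∸n≤m m s)))))

    AssembledBelow-card : ∀ K → K ≤ suc m → HasCard (AssembledBelow K) (sum1 K F)
    AssembledBelow-card zero    _ = HasCard-∅ (λ { _ (_ , () , _) })
    AssembledBelow-card (suc K) K<1+m =
      HasCard-cong ⊎⇒below below⇒⊎
        (HasCard-⊎ (AssembledBelow-card K (≤-trans (n≤1+n K) K<1+m)) (AssembledFrom-card K (≤-pred K<1+m))
          (λ { ps (s , s<K , from-s) from-K → <-irrefl (disjoint (≤-pred (≤-trans (m<n⇒m<1+n s<K) K<1+m)) (≤-pred K<1+m) from-s from-K) s<K }))
      where
      ⊎⇒below : ∀ ps → AssembledBelow K ps ⊎ AssembledFrom R assemble m K ps → AssembledBelow (suc K) ps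
      ⊎⇒below ps (inj₁ (s , s<K , from-s)) = s , m<n⇒m<1+n s<K , from-s
      ⊎⇒below ps (inj₂ from-K)             = K , ≤-refl , from-K
      below⇒⊎ : ∀ ps → AssembledBelow (suc K) ps → AssembledBelow K ps ⊎ AssembledFrom R assemble m K ps
      below⇒⊎ ps (s , s<1+K , from-s) with <-cmp s K
      ... | tri< s<K _ _  = inj₁ (s , s<K , from-s)
      ... | tri≈ _ refl _ = inj₂ from-s
      ... | tri> _ _ K<s  = ⊥-elim (<⇒≱ K<s (≤-pred s<1+K))

    PkList-suc : HasCard (PkList R (suc m)) (sum1 (suc m) F)
    PkList-suc = HasCard-cong (λ ps (s , s<1+m , from-s) → sound (≤-pred s<1+m) from-s)
                              (λ ps pk → let s , s≤m , from-s = complete m ps pk in s , s≤s s≤m , from-s)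
                              (AssembledBelow-card (suc m) ≤-refl)

  PkList-card : (p : ℕ → ℕ) → p 0 ≡ 1 → ((n : ℕ) → p (suc n) ≡ sum1 (suc n) (λ k → k * p (k ∸ 1) * p (suc n ∸ k))) →
                ∀ n → HasCard (PkList R n) (p n)
  PkList-card p p0 p-suc n = below (suc n) n ≤-refl
    where
    below : ∀ N n → n < N → HasCard (PkList R n) (p n)
    below (suc N) zero    _          = subst (HasCard _) (sym p0) PkList-0
    below (suc N) (suc m) (s≤s m<N) = subst (HasCard _) (sym (p-suc m)) (PkList-suc p m (λ n n≤m → below N n (<-≤-trans (s≤s n≤m) m<N)))

module Enumeration where

  open Street
  open Labels
  open Patterns
  open Assembly
  open Soundness using (sound132; sound231)
  open Completeness using (complete132; complete231)

  ++-injective-length : ∀ {A : Set} (xs xs′ : List A) {ys ys′} → length xs ≡ length xs′ → xs ++ ys ≡ xs′ ++ ys′ → xs ≡ xs′ × ys ≡ ys′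
  ++-injective-length []       []         _       e = refl , e
  ++-injective-length (x ∷ xs) (x′ ∷ xs′) length≡ e
    with xs≡ , ys≡ ← ++-injective-length xs xs′ (suc-injective length≡) (∷-injectiveʳ e)
    = cong₂ _∷_ (∷-injectiveˡ e) xs≡ , ys≡

  private
    length-shifted : ∀ {R m s a g h a′ g′ h′} → ValidPieces R m s (a , g , h) → ValidPieces R m s (a′ , g′ , h′) →
                     length (map (suc s +_) h) ≡ length (map (suc s +_) h′)
    length-shifted {h = h} {h′ = h′} (_ , _ , (length-h , _)) (_ , _ , (length-h′ , _)) =
      trans (length-map _ h) (trans length-h (sym (trans (length-map _ h′) length-h′)))

    unshift-injective : ∀ s {h h′} → map (suc s +_) h ≡ map (suc s +_) h′ → h ≡ h′
    unshift-injective s = map-injective (+-cancelˡ-≡ (suc s) _ _)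

  assemble132-injective : ∀ {R m s t t′} → ValidPieces R m s t → ValidPieces R m s t′ → assemble132 s t ≡ assemble132 s t′ → t ≡ t′
  assemble132-injective {s = s} {a , g , h} {a′ , g′ , h′} valid valid′ e
    with H≡ , rest ← ++-injective-length (map (suc s +_) h) (map (suc s +_) h′) (length-shifted valid valid′) e
    with g≡ , a≡ ← ∷ʳ-injective g g′ rest
    = cong₂ _,_ a≡ (cong₂ _,_ g≡ (unshift-injective s H≡))

  assemble231-injective : ∀ {R m s t t′} → ValidPieces R m s t → ValidPieces R m s t′ → assemble231 s t ≡ assemble231 s t′ → t ≡ t′
  assemble231-injective {s = s} {a , g , h} {a′ , g′ , h′} valid@(_ , (length-g , _) , _) valid′@(_ , (length-g′ , _) , _) e
    with g≡ , rest ← ++-injective-length g g′ (trans length-g (sym length-g′)) e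
    with H≡ , a≡ ← ∷ʳ-injective (map (suc s +_) h) (map (suc s +_) h′) rest
    = cong₂ _,_ a≡ (cong₂ _,_ g≡ (unshift-injective s H≡))

  -- Pins down s as the position of the first occurrence of label m+1.
  LastCarAt : ℕ → ℕ → List ℕ → Set
  LastCarAt m s ps = ∃ λ Gp → ∃ λ Hp →
    parkCars (label 1 ps) (vacant (suc m)) ≡ Gp ++ just (suc m) ∷ Hp × length Gp ≡ s × All (_≢ just (suc m)) Gp

  position-unique : ∀ (o o′ : Street) {x o₁ o₁′} → o ++ x ∷ o₁ ≡ o′ ++ x ∷ o₁′ →
                    All (_≢ x) o → All (_≢ x) o′ → length o ≡ length o′
  position-unique []      []       _ _          _          = refl
  position-unique []      (y ∷ o′) e _          (y≢x ∷ _)  = ⊥-elim (y≢x (sym (∷-injectiveˡ e)))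
  position-unique (y ∷ o) []       e (y≢x ∷ _)  _          = ⊥-elim (y≢x (∷-injectiveˡ e))
  position-unique (y ∷ o) (y′ ∷ o′) e (_ ∷ o≢x) (_ ∷ o′≢x) = cong suc (position-unique o o′ (∷-injectiveʳ e) o≢x o′≢x)

  LastCarAt-unique : ∀ {m s s′ ps} → LastCarAt m s ps → LastCarAt m s′ ps → s ≡ s′
  LastCarAt-unique (Gp , Hp , e , refl , Gp≢) (Gp′ , Hp′ , e′ , refl , Gp′≢) = position-unique Gp Gp′ (trans (sym e) e′) Gp≢ Gp′≢

  lastCarAt132 : ∀ {m s ps} → s ≤ m → AssembledFrom Is132 assemble132 m s ps → LastCarAt m s ps
  lastCarAt132 {m} {s} s≤m ((a , g , h) , (a<1+s , (length-g , g<s , g-parking , _) , (length-h , _)) , refl) =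
    Gp , _ , parkCars-assemble132 {h = h} s≤m (≤-pred a<1+s) length-g g<s g-parking length-h , length-parkCars-vacant Left s ,
    labels-below (suc (m ∸ s)) (suc m) (suc m) Gp ≤-refl
      (parkCars-labels-in-range (suc (m ∸ s)) (suc m) (suc (m ∸ s)) g (vacant s) (vacant-labels s) ≤-refl
        (≤-reflexive (cong suc (trans (cong (m ∸ s +_) length-g) (trans (+-comm (m ∸ s) s) (m+[n∸m]≡n s≤m))))))
    where
    Left = label (suc (m ∸ s)) g
    Gp = parkCars Left (vacant s)

  lastCarAt231 : ∀ {m s ps} → s ≤ m → AssembledFrom Is231 assemble231 m s ps → LastCarAt m s ps
  lastCarAt231 {m} {s} s≤m ((a , g , h) , (a<1+s , (length-g , g<s , g-parking , _) , (length-h , _)) , refl) =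
    Gp , _ , parkCars-assemble231 {h = h} s≤m (≤-pred a<1+s) length-g g<s g-parking length-h , length-parkCars-vacant Left s ,
    labels-below 1 (suc s) (suc m) Gp (s≤s s≤m)
      (parkCars-labels-in-range 1 (suc s) 1 g (vacant s) (vacant-labels s) ≤-refl (≤-reflexive (cong suc length-g)))
    where
    Left = label 1 g
    Gp = parkCars Left (vacant s)

  assembled132-disjoint : ∀ {m s s′ ps} → s ≤ m → s′ ≤ m →
                          AssembledFrom Is132 assemble132 m s ps → AssembledFrom Is132 assemble132 m s′ ps → s ≡ s′
  assembled132-disjoint {ps = ps} s≤m s′≤m from from′ = LastCarAt-unique {ps = ps} (lastCarAt132 s≤m from) (lastCarAt132 s′≤m from′)

  assembled231-disjoint : ∀ {m s s′ ps} → s ≤ m → s′ ≤ m →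
                          AssembledFrom Is231 assemble231 m s ps → AssembledFrom Is231 assemble231 m s′ ps → s ≡ s′
  assembled231-disjoint {ps = ps} s≤m s′≤m from from′ = LastCarAt-unique {ps = ps} (lastCarAt231 s≤m from) (lastCarAt231 s′≤m from′)

  module PkList132 = Counting Is132 assemble132 sound132
                              complete132 assembled132-disjoint assemble132-injective

  module PkList231 = Counting Is231 assemble231 sound231
                              complete231 assembled231-disjoint assemble231-injective

module Vectors where

  open Street
  open Labels using (readOff)
  open Patterns using (nth)
  open ParkingWords using (parkingWord)

  prefs : ∀ {n k} → Vec (Fin n) k → List ℕ
  prefs v = Vec.toList (Vec.map toℕ v)

  length-prefs : ∀ {n k} (v : Vec (Fin n) k) → length (prefs v) ≡ k
  length-prefs []      = refl
  length-prefs (x ∷ v) = cong suc (length-prefs v)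

  prefs<n : ∀ {n k} (v : Vec (Fin n) k) → All (_< n) (prefs v)
  prefs<n []      = []
  prefs<n (x ∷ v) = toℕ<n x ∷ prefs<n v

  -- Out-of-range preferences (never used on the lists that matter) become spot 0.
  toFin : ∀ {n} → ℕ → Fin (suc n)
  toFin {n} x with x <? suc n
  ... | yes x< = fromℕ< x<
  ... | no _   = Fin.zero

  toFin-toℕ : ∀ {n} (i : Fin (suc n)) → toFin (toℕ i) ≡ i
  toFin-toℕ {n} i with toℕ i <? suc n
  ... | yes i< = fromℕ<-toℕ i i<
  ... | no i≮  = ⊥-elim (i≮ (toℕ<n i))

  toℕ-toFin : ∀ {n} x → x < suc n → toℕ (toFin {n} x) ≡ x
  toℕ-toFin {n} x x< with x <? suc n
  ... | yes x<′ = toℕ-fromℕ< x<′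
  ... | no x≮   = ⊥-elim (x≮ x<)

  fromPrefs : ∀ {n} k → List ℕ → Vec (Fin (suc n)) k
  fromPrefs zero    _        = []
  fromPrefs (suc k) []       = Fin.zero ∷ fromPrefs k []
  fromPrefs (suc k) (p ∷ ps) = toFin p ∷ fromPrefs k ps

  toVec : ∀ n → List ℕ → Vec (Fin n) n
  toVec zero    _  = []
  toVec (suc n) ps = fromPrefs (suc n) ps

  toVec-prefs : ∀ n (v : Vec (Fin n) n) → toVec n (prefs v) ≡ v
  toVec-prefs zero    []    = refl
  toVec-prefs (suc n) v     = fromPrefs-prefs v
    where
    fromPrefs-prefs : ∀ {k} (w : Vec (Fin (suc n)) k) → fromPrefs k (prefs w) ≡ w
    fromPrefs-prefs []      = refl
    fromPrefs-prefs (x ∷ w) = cong₂ _∷_ (toFin-toℕ x) (fromPrefs-prefs w)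

  prefs-toVec : ∀ n ps → length ps ≡ n → All (_< n) ps → prefs (toVec n ps) ≡ ps
  prefs-toVec zero    []       _ _  = refl
  prefs-toVec (suc n) ps length≡ ps< = prefs-fromPrefs (suc n) ps length≡ ps<
    where
    prefs-fromPrefs : ∀ k ps → length ps ≡ k → All (_< suc n) ps → prefs (fromPrefs {n} k ps) ≡ ps
    prefs-fromPrefs zero    []       _       _          = refl
    prefs-fromPrefs (suc k) (p ∷ ps) length≡ (p< ∷ ps<) = cong₂ _∷_ (toℕ-toFin p p<) (prefs-fromPrefs k ps (suc-injective length≡) ps<)

  countLe≡countAtMost : ∀ {n k} (v : Vec (Fin n) k) (i : Fin n) → Vec.count (λ x → toℕ x ≤? toℕ i) v ≡ countAtMost (toℕ i) (prefs v)
  countLe≡countAtMost []      i = refl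
  countLe≡countAtMost (x ∷ v) i =
    trans (cong (if (toℕ x ≤ᵇ toℕ i) then suc else id) (countLe≡countAtMost v i)) (step (toℕ x) (toℕ i) _)
    where
    step : ∀ a b k → (if (a ≤ᵇ b) then suc else id) k ≡ indicator≤ a b + k
    step zero          b       k = refl
    step (suc a)       zero    k = refl
    step (suc zero)    (suc b) k = refl
    step (suc (suc a)) (suc b) k = step (suc a) b k

  IsParking⇒IsParkingList : ∀ {n} (v : Vec (Fin n) n) → IsParking v → IsParkingList n (prefs v)
  IsParking⇒IsParkingList v parking i i<n =
    subst (λ j → suc j ≤ countAtMost j (prefs v)) (toℕ-fromℕ< i<n)
      (subst (suc (toℕ (fromℕ< i<n)) ≤_) (countLe≡countAtMost v (fromℕ< i<n)) (parking (fromℕ< i<n)))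

  IsParkingList⇒IsParking : ∀ {n} (v : Vec (Fin n) n) → IsParkingList n (prefs v) → IsParking v
  IsParkingList⇒IsParking v parking i = subst (suc (toℕ i) ≤_) (sym (countLe≡countAtMost v i)) (parking (toℕ i) (toℕ<n i))

  toList-parkFrom : ∀ {k} s c (o : Vec (Maybe ℕ) k) → Vec.toList (parkFrom s c o) ≡ park s c (Vec.toList o)
  toList-parkFrom s       c []            = refl
  toList-parkFrom zero    c (nothing ∷ o) = refl
  toList-parkFrom zero    c (just x ∷ o)  = cong (just x ∷_) (toList-parkFrom zero c o)
  toList-parkFrom (suc s) c (x ∷ o)       = cong (x ∷_) (toList-parkFrom s c o)

  toList-parkAll : ∀ {n k} c (v : Vec (Fin n) k) (o : Vec (Maybe ℕ) n) → Vec.toList (parkAll c v o) ≡ parkCars (label c (prefs v)) (Vec.toList o)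
  toList-parkAll c []      o = refl
  toList-parkAll c (p ∷ v) o =
    trans (toList-parkAll (suc c) v (parkFrom (toℕ p) c o)) (cong (parkCars (label (suc c) (prefs v))) (toList-parkFrom (toℕ p) c o))

  toList-replicate : ∀ n → Vec.toList (Vec.replicate n (nothing {A = ℕ})) ≡ vacant n
  toList-replicate zero    = refl
  toList-replicate (suc n) = cong (nothing ∷_) (toList-replicate n)

  lookup≡spot : ∀ {k} (o : Vec (Maybe ℕ) k) i → Vec.lookup o i ≡ spot (Vec.toList o) (toℕ i)
  lookup≡spot (x ∷ o) Fin.zero    = refl
  lookup≡spot (x ∷ o) (Fin.suc i) = lookup≡spot o i

  nth-readOff : ∀ o i → nth (readOff o) i ≡ fromMaybe 0 (spot o i)
  nth-readOff []      i       = refl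
  nth-readOff (x ∷ o) zero    = refl
  nth-readOff (x ∷ o) (suc i) = nth-readOff o i

  parkingPerm≡nth : ∀ {n} (v : Vec (Fin n) n) (i : Fin n) → parkingPerm v i ≡ nth (parkingWord n (prefs v)) (toℕ i)
  parkingPerm≡nth {n} v i = begin
    fromMaybe 0 (Vec.lookup (occupancy v) i)                       ≡⟨ cong (fromMaybe 0) (lookup≡spot (occupancy v) i) ⟩
    fromMaybe 0 (spot (Vec.toList (occupancy v)) (toℕ i))          ≡⟨ cong (λ o → fromMaybe 0 (spot o (toℕ i))) occupancy≡ ⟩
    fromMaybe 0 (spot (parkCars (label 1 (prefs v)) (vacant n)) (toℕ i)) ≡⟨ sym (nth-readOff (parkCars (label 1 (prefs v)) (vacant n)) (toℕ i)) ⟩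
    nth (parkingWord n (prefs v)) (toℕ i)                          ∎
    where
    open ≡-Reasoning
    occupancy≡ : Vec.toList (occupancy v) ≡ parkCars (label 1 (prefs v)) (vacant n)
    occupancy≡ = trans (toList-parkAll 1 v (Vec.replicate n nothing)) (cong (parkCars (label 1 (prefs v))) (toList-replicate n))

module Containment where

  open Patterns

  pattern #0 = Fin.zero
  pattern #1 = Fin.suc Fin.zero
  pattern #2 = Fin.suc (Fin.suc Fin.zero)

  triple : ∀ {A : Set} → A → A → A → Fin 3 → A
  triple x y z #0 = x
  triple x y z #1 = y
  triple x y z #2 = z

  SameOrder : ∀ {m} → (Fin m → ℕ) → Vec ℕ m → Set
  SameOrder W σ = ∀ a b → (W a < W b → Vec.lookup σ a < Vec.lookup σ b) × (Vec.lookup σ a < Vec.lookup σ b → W a < W b)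

  private
    Agree : ℕ → ℕ → ℕ → ℕ → Set
    Agree u v s t = (u < v → s < t) × (s < t → u < v)

    diagonal : ∀ {u s} → Agree u u s s
    diagonal = (λ u<u → ⊥-elim (<-irrefl refl u<u)) , (λ s<s → ⊥-elim (<-irrefl refl s<s))

    agree : ∀ {u v s t} → s < t → u < v → Agree u v s t
    agree s<t u<v = (λ _ → s<t) , (λ _ → u<v)

    disagree : ∀ {u v s t} → v < u → t < s → Agree u v s t
    disagree v<u t<s = (λ u<v → ⊥-elim (<-asym u<v v<u)) , (λ s<t → ⊥-elim (<-asym s<t t<s))

    1<3 : 1 < 3
    1<3 = s≤s (s≤s z≤n)

  Is132⇒SameOrder : ∀ {x y z} → Is132 x y z → SameOrder (triple x y z) pat132
  Is132⇒SameOrder (x<z , z<y) = λ where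
    #0 #0 → diagonal
    #0 #1 → agree 1<3 (<-trans x<z z<y)
    #0 #2 → agree ≤-refl x<z
    #1 #0 → disagree (<-trans x<z z<y) 1<3
    #1 #1 → diagonal
    #1 #2 → disagree z<y ≤-refl
    #2 #0 → disagree x<z ≤-refl
    #2 #1 → agree ≤-refl z<y
    #2 #2 → diagonal

  Is231⇒SameOrder : ∀ {x y z} → Is231 x y z → SameOrder (triple x y z) pat231
  Is231⇒SameOrder (z<x , x<y) = λ where
    #0 #0 → diagonal
    #0 #1 → agree ≤-refl x<y
    #0 #2 → disagree z<x ≤-refl
    #1 #0 → disagree x<y ≤-refl
    #1 #1 → diagonal
    #1 #2 → disagree (<-trans z<x x<y) 1<3
    #2 #0 → agree ≤-refl z<x
    #2 #1 → agree 1<3 (<-trans z<x x<y)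
    #2 #2 → diagonal

  SameOrder⇒Is132 : ∀ {W : Fin 3 → ℕ} → SameOrder W pat132 → Is132 (W #0) (W #1) (W #2)
  SameOrder⇒Is132 same = proj₂ (same #0 #2) ≤-refl , proj₂ (same #2 #1) ≤-refl

  SameOrder⇒Is231 : ∀ {W : Fin 3 → ℕ} → SameOrder W pat231 → Is231 (W #0) (W #1) (W #2)
  SameOrder⇒Is231 same = proj₂ (same #2 #0) ≤-refl , proj₂ (same #0 #1) ≤-refl

  triple-increasing : ∀ {i j k} → i < j → j < k → ∀ a b → a Fin.< b → triple i j k a < triple i j k b
  triple-increasing i<j j<k #0 #1 _ = i<j
  triple-increasing i<j j<k #0 #2 _ = <-trans i<j j<k
  triple-increasing i<j j<k #1 #2 _ = j<k
  triple-increasing i<j j<k #0 #0 ()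
  triple-increasing i<j j<k #1 #0 ()
  triple-increasing i<j j<k #1 #1 (s≤s ())
  triple-increasing i<j j<k #2 #0 ()
  triple-increasing i<j j<k #2 #1 (s≤s ())
  triple-increasing i<j j<k #2 #2 (s≤s (s≤s ()))

  module _ {n : ℕ} (π : Fin n → ℕ) (w : List ℕ) (length-w : length w ≡ n) (π≡ : ∀ i → π i ≡ nth w (toℕ i)) where

    Contains⇒Occurs : ∀ {R σ} → (∀ {W : Fin 3 → ℕ} → SameOrder W σ → R (W #0) (W #1) (W #2)) → Contains π σ → Occurs R w
    Contains⇒Occurs {R} same⇒R (ι , increasing , same) =
      occurrence (toℕ (ι #0)) (toℕ (ι #1)) (toℕ (ι #2)) (increasing #0 #1 (s≤s z≤n)) (increasing #1 #2 (s≤s (s≤s z≤n)))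
        (subst (toℕ (ι #2) <_) (sym length-w) (toℕ<n (ι #2)))
        (subst₃ (π≡ (ι #0)) (π≡ (ι #1)) (π≡ (ι #2)) (same⇒R {π ∘ ι} same))
      where
      subst₃ : ∀ {a a′ b b′ c c′} → a ≡ a′ → b ≡ b′ → c ≡ c′ → R a b c → R a′ b′ c′
      subst₃ refl refl refl r = r

    Occurs⇒Contains : ∀ {R σ} → (∀ {x y z} → R x y z → SameOrder (triple x y z) σ) → Occurs R w → Contains π σ
    Occurs⇒Contains {R} {σ} R⇒same (occurrence i j k i<j j<k k< r) = ι , increasing , same
      where
      bound : ∀ a → triple i j k a < n
      bound a = subst (_ <_) length-w (<-≤-trans (triple-≤k a) k<)
        where
        triple-≤k : ∀ a → triple i j k a < suc k
        triple-≤k #0 = m<n⇒m<1+n (<-trans i<j j<k)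
        triple-≤k #1 = m<n⇒m<1+n j<k
        triple-≤k #2 = ≤-refl
      ι : Fin 3 → Fin n
      ι a = fromℕ< (bound a)
      increasing : ∀ a b → a Fin.< b → ι a Fin.< ι b
      increasing a b a<b = subst₂ _<_ (sym (toℕ-fromℕ< (bound a))) (sym (toℕ-fromℕ< (bound b))) (triple-increasing i<j j<k a b a<b)
      values : ∀ a → π (ι a) ≡ triple (nth w i) (nth w j) (nth w k) a
      values a = trans (π≡ (ι a)) (trans (cong (nth w) (toℕ-fromℕ< (bound a))) (nth-triple a))
        where
        nth-triple : ∀ a → nth w (triple i j k a) ≡ triple (nth w i) (nth w j) (nth w k) a
        nth-triple #0 = refl
        nth-triple #1 = refl
        nth-triple #2 = refl
      same : SameOrder (π ∘ ι) σ
      same a b = (λ lt → proj₁ (R⇒same r a b) (subst₂ _<_ (values a) (values b) lt)) ,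
                 (λ lt → subst₂ _<_ (sym (values a)) (sym (values b)) (proj₂ (R⇒same r a b) lt))

module PowerSeries where

  sum≤ : ℕ → (ℕ → ℕ) → ℕ
  sum≤ zero    f = f 0
  sum≤ (suc n) f = sum≤ n f + f (suc n)

  sum≤-cong : ∀ n {f g} → (∀ i → i ≤ n → f i ≡ g i) → sum≤ n f ≡ sum≤ n g
  sum≤-cong zero    f≡g = f≡g 0 z≤n
  sum≤-cong (suc n) f≡g = cong₂ _+_ (sum≤-cong n (λ i i≤n → f≡g i (m≤n⇒m≤1+n i≤n))) (f≡g (suc n) ≤-refl)

  sum≤-+ : ∀ n f g → sum≤ n (λ i → f i + g i) ≡ sum≤ n f + sum≤ n g
  sum≤-+ zero    f g = refl
  sum≤-+ (suc n) f g = trans (cong (_+ (f (suc n) + g (suc n))) (sum≤-+ n f g)) (interchange (sum≤ n f) (sum≤ n g) (f (suc n)) (g (suc n)))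

  sum≤-suc : ∀ n f → sum≤ (suc n) f ≡ f 0 + sum≤ n (f ∘ suc)
  sum≤-suc zero    f = refl
  sum≤-suc (suc n) f = trans (cong (_+ f (suc (suc n))) (sum≤-suc n f)) (+-assoc (f 0) _ _)

  sum≤-reverse : ∀ n f → sum≤ n f ≡ sum≤ n (λ i → f (n ∸ i))
  sum≤-reverse zero    f = refl
  sum≤-reverse (suc n) f = begin
    sum≤ (suc n) f                                   ≡⟨ sum≤-suc n f ⟩
    f 0 + sum≤ n (f ∘ suc)                           ≡⟨ cong (f 0 +_) (sum≤-reverse n (f ∘ suc)) ⟩
    f 0 + sum≤ n (λ i → f (suc (n ∸ i)))             ≡⟨ +-comm (f 0) _ ⟩
    sum≤ n (λ i → f (suc (n ∸ i))) + f 0             ≡⟨ cong₂ _+_ (sum≤-cong n (λ i i≤n → cong f (sym (+-∸-assoc 1 i≤n))))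
                                                                  (cong f (sym (n∸n≡0 n))) ⟩
    sum≤ n (λ i → f (suc n ∸ i)) + f (n ∸ n)         ∎
    where open ≡-Reasoning

  sum1≡sum≤ : ∀ n g → sum1 (suc n) g ≡ sum≤ n (g ∘ suc)
  sum1≡sum≤ zero    g = refl
  sum1≡sum≤ (suc n) g = cong (_+ g (suc (suc n))) (sum1≡sum≤ n g)

  sumℤ0-cong : ∀ n {f g} → (∀ i → i ≤ n → f i ≡ g i) → sumℤ0 n f ≡ sumℤ0 n g
  sumℤ0-cong zero    f≡g = f≡g 0 z≤n
  sumℤ0-cong (suc n) f≡g = cong₂ ℤ._+_ (sumℤ0-cong n (λ i i≤n → f≡g i (m≤n⇒m≤1+n i≤n))) (f≡g (suc n) ≤-refl)

  sumℤ0-suc : ∀ n f → sumℤ0 (suc n) f ≡ f 0 ℤ.+ sumℤ0 n (f ∘ suc)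
  sumℤ0-suc zero    f = refl
  sumℤ0-suc (suc n) f = trans (cong (ℤ._+ f (suc (suc n))) (sumℤ0-suc n f)) (ℤᵖ.+-assoc (f 0) _ _)

  sumℤ0-+ : ∀ n f → sumℤ0 n (λ i → ℤ.+ f i) ≡ ℤ.+ sum≤ n f
  sumℤ0-+ zero    f = refl
  sumℤ0-+ (suc n) f = trans (cong (ℤ._+ ℤ.+ f (suc n)) (sumℤ0-+ n f)) (sym (ℤᵖ.pos-+ (sum≤ n f) (f (suc n))))

  sumℤ0-0 : ∀ n → sumℤ0 n (λ _ → ℤ.+ 0) ≡ ℤ.+ 0
  sumℤ0-0 zero    = refl
  sumℤ0-0 (suc n) = cong (ℤ._+ ℤ.+ 0) (sumℤ0-0 n)

  oneS-⊛ : ∀ Y n → (oneS ⊛ Y) n ≡ Y n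
  oneS-⊛ Y zero    = ℤᵖ.*-identityˡ (Y 0)
  oneS-⊛ Y (suc n) = begin
    (oneS ⊛ Y) (suc n)                              ≡⟨ sumℤ0-suc n _ ⟩
    ℤ.+ 1 ℤ.* Y (suc n) ℤ.+ sumℤ0 n (λ _ → ℤ.+ 0)   ≡⟨ cong₂ ℤ._+_ (ℤᵖ.*-identityˡ (Y (suc n))) (sumℤ0-0 n) ⟩
    Y (suc n) ℤ.+ ℤ.+ 0                             ≡⟨ ℤᵖ.+-identityʳ (Y (suc n)) ⟩
    Y (suc n)                                       ∎
    where open ≡-Reasoning

  -- xS is oneS shifted by one place.
  xS-⊛-suc : ∀ Y n → (xS ⊛ Y) (suc n) ≡ Y n
  xS-⊛-suc Y n = trans (sumℤ0-suc n _) (trans (ℤᵖ.+-identityˡ _) (trans (sumℤ0-cong n (λ i _ → x≡shifted-one i)) (oneS-⊛ Y n)))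
    where
    x≡shifted-one : ∀ i → xS (suc i) ℤ.* Y (n ∸ i) ≡ oneS i ℤ.* Y (n ∸ i)
    x≡shifted-one zero    = refl
    x≡shifted-one (suc i) = refl

  x²-⊛ : ∀ Y n → ((xS ⊛ xS) ⊛ Y) (suc n) ≡ (xS ⊛ Y) n
  x²-⊛ Y n = trans (sumℤ0-suc n _) (trans (ℤᵖ.+-identityˡ _) (sumℤ0-cong n (λ i _ → cong (ℤ._* Y (n ∸ i)) (xS-⊛-suc xS i))))

  module _ (p : ℕ → ℕ) (p0 : p 0 ≡ 1)
           (p-suc : (n : ℕ) → p (suc n) ≡ sum1 (suc n) (λ k → k * p (k ∸ 1) * p (suc n ∸ k))) where

    private
      P : FPS
      P = λ n → ℤ.+ p n

    -- Split the weight k = 1 + i, and reflect i ↦ n − i in the part weighted by i.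
    recurrence-split : ∀ m → p (suc (suc m)) ≡ sum≤ m (λ i → p i * (suc (m ∸ i) * p (suc (m ∸ i)))) + sum≤ (suc m) (λ i → p i * p (suc m ∸ i))
    recurrence-split m = begin
      p (suc n)                                                          ≡⟨ p-suc n ⟩
      sum1 (suc n) (λ k → k * p (k ∸ 1) * p (suc n ∸ k))                  ≡⟨ sum1≡sum≤ n _ ⟩
      sum≤ n (λ i → suc i * p i * p (n ∸ i))                              ≡⟨ sum≤-cong n (λ i _ → split-weight i (p i) (p (n ∸ i))) ⟩
      sum≤ n (λ i → p i * p (n ∸ i) + i * (p i * p (n ∸ i)))              ≡⟨ sum≤-+ n _ _ ⟩
      convolution + sum≤ n (λ i → i * (p i * p (n ∸ i)))                  ≡⟨ cong (convolution +_) (sum≤-reverse n _) ⟩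
      convolution + sum≤ n (λ i → (n ∸ i) * (p (n ∸ i) * p (n ∸ (n ∸ i)))) ≡⟨ cong (convolution +_) (sum≤-cong n reflected) ⟩
      convolution + sum≤ n (λ i → p i * ((n ∸ i) * p (n ∸ i)))            ≡⟨ cong (convolution +_) last-term-vanishes ⟩
      convolution + sum≤ m (λ i → p i * ((n ∸ i) * p (n ∸ i)))            ≡⟨ cong (convolution +_) (sum≤-cong m (λ i i≤m → cong (λ k → p i * (k * p k)) (+-∸-assoc 1 i≤m))) ⟩
      convolution + weighted                                             ≡⟨ +-comm convolution weighted ⟩
      weighted + convolution                                             ∎
      where
      open ≡-Reasoning
      n = suc m
      convolution = sum≤ n (λ i → p i * p (n ∸ i))
      weighted = sum≤ m (λ i → p i * (suc (m ∸ i) * p (suc (m ∸ i))))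
      split-weight : ∀ i x y → suc i * x * y ≡ x * y + i * (x * y)
      split-weight i x y = trans (*-distribʳ-+ y x (i * x)) (cong (x * y +_) (*-assoc i x y))
      reflected : ∀ i → i ≤ n → (n ∸ i) * (p (n ∸ i) * p (n ∸ (n ∸ i))) ≡ p i * ((n ∸ i) * p (n ∸ i))
      reflected i i≤n = trans (cong (λ k → (n ∸ i) * (p (n ∸ i) * p k)) (m∸[m∸n]≡n i≤n))
                              (trans (sym (*-assoc (n ∸ i) (p (n ∸ i)) (p i))) (*-comm ((n ∸ i) * p (n ∸ i)) (p i)))
      f : ℕ → ℕ
      f i = p i * ((n ∸ i) * p (n ∸ i))
      last-term-vanishes : sum≤ n f ≡ sum≤ m f
      last-term-vanishes = trans (cong (λ k → sum≤ m f + p n * (k * p k)) (n∸n≡0 n)) (trans (cong (sum≤ m f +_) (*-zeroʳ (p n))) (+-identityʳ _))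

    coefficients-vanish : (n : ℕ) → ((((xS ⊛ xS) ⊛ (P ⊛ deriv P)) ⊕ (xS ⊛ (P ⊛ P))) ⊕ ((⊖ P) ⊕ oneS)) n ≡ ℤ.+ 0
    coefficients-vanish zero rewrite p0 = refl
    coefficients-vanish (suc zero) = begin
      ((xS ⊛ xS) ⊛ (P ⊛ deriv P)) 1 ℤ.+ (xS ⊛ (P ⊛ P)) 1 ℤ.+ (ℤ.- P 1 ℤ.+ ℤ.+ 0)
        ≡⟨ cong₂ (λ u v → u ℤ.+ v ℤ.+ (ℤ.- P 1 ℤ.+ ℤ.+ 0)) (x²-⊛ (P ⊛ deriv P) 0) (xS-⊛-suc (P ⊛ P) 0) ⟩
      ℤ.+ 0 ℤ.+ ℤ.+ p 0 ℤ.* ℤ.+ p 0 ℤ.+ (ℤ.- ℤ.+ p 1 ℤ.+ ℤ.+ 0)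
        ≡⟨ cong₂ (λ u v → ℤ.+ 0 ℤ.+ ℤ.+ u ℤ.* ℤ.+ u ℤ.+ (ℤ.- ℤ.+ v ℤ.+ ℤ.+ 0)) p0 (trans (p-suc 0) (cong (λ k → 0 + 1 * k * k) p0)) ⟩
      ℤ.+ 0 ∎
      where open ≡-Reasoning
    coefficients-vanish (suc (suc m)) = begin
      ((xS ⊛ xS) ⊛ (P ⊛ deriv P)) (2 + m) ℤ.+ (xS ⊛ (P ⊛ P)) (2 + m) ℤ.+ (ℤ.- P (2 + m) ℤ.+ ℤ.+ 0)
        ≡⟨ cong₂ (λ u v → u ℤ.+ v ℤ.+ (ℤ.- P (2 + m) ℤ.+ ℤ.+ 0))
                 (trans (x²-⊛ (P ⊛ deriv P) (suc m)) (xS-⊛-suc (P ⊛ deriv P) m)) (xS-⊛-suc (P ⊛ P) (suc m)) ⟩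
      (P ⊛ deriv P) m ℤ.+ (P ⊛ P) (suc m) ℤ.+ (ℤ.- ℤ.+ p (2 + m) ℤ.+ ℤ.+ 0)
        ≡⟨ cong₂ (λ u v → u ℤ.+ v ℤ.+ (ℤ.- ℤ.+ p (2 + m) ℤ.+ ℤ.+ 0)) P⊛P′≡weighted P⊛P≡convolution ⟩
      ℤ.+ weighted ℤ.+ ℤ.+ convolution ℤ.+ (ℤ.- ℤ.+ p (2 + m) ℤ.+ ℤ.+ 0)
        ≡⟨ cong₂ ℤ._+_ (sym (ℤᵖ.pos-+ weighted convolution)) (trans (ℤᵖ.+-identityʳ _) (cong (λ k → ℤ.- ℤ.+ k) (recurrence-split m))) ⟩
      ℤ.+ (weighted + convolution) ℤ.+ ℤ.- ℤ.+ (weighted + convolution)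
        ≡⟨ ℤᵖ.+-inverseʳ (ℤ.+ (weighted + convolution)) ⟩
      ℤ.+ 0 ∎
      where
      open ≡-Reasoning
      weighted = sum≤ m (λ i → p i * (suc (m ∸ i) * p (suc (m ∸ i))))
      convolution = sum≤ (suc m) (λ i → p i * p (suc m ∸ i))
      P⊛P′≡weighted : (P ⊛ deriv P) m ≡ ℤ.+ weighted
      P⊛P′≡weighted = trans (sumℤ0-cong m (λ i _ → trans (cong (ℤ.+ p i ℤ.*_) (sym (ℤᵖ.pos-* (suc (m ∸ i)) (p (suc (m ∸ i))))))
                                                         (sym (ℤᵖ.pos-* (p i) _))))
                            (sumℤ0-+ m _)
      P⊛P≡convolution : (P ⊛ P) (suc m) ≡ ℤ.+ convolution
      P⊛P≡convolution = trans (sumℤ0-cong (suc m) (λ i _ → sym (ℤᵖ.pos-* (p i) (p (suc m ∸ i))))) (sumℤ0-+ (suc m) _)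

module Transfer where

  open ParkingWords
  open Vectors
  open Containment
  open Cardinality

  module _ {R : ℕ → ℕ → ℕ → Set} (σ : Vec ℕ 3) (R⇒same : ∀ {x y z} → R x y z → SameOrder (triple x y z) σ)
           (same⇒R : ∀ {W : Fin 3 → ℕ} → SameOrder W σ → R (W #0) (W #1) (W #2)) where

    PkProp⇒PkList : ∀ {n} (v : Vec (Fin n) n) → PkProp n σ v → PkList R n (prefs v)
    PkProp⇒PkList {n} v (parking , avoids) =
      length-prefs v , prefs<n v , IsParking⇒IsParkingList v parking ,
      avoids ∘ Occurs⇒Contains (parkingPerm v) (parkingWord n (prefs v)) (length-parkingWord n (prefs v)) (parkingPerm≡nth v) {σ = σ} R⇒same

    PkList⇒PkProp : ∀ {n} (v : Vec (Fin n) n) → PkList R n (prefs v) → PkProp n σ v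
    PkList⇒PkProp {n} v (_ , _ , parking , avoids) =
      IsParkingList⇒IsParking v parking ,
      avoids ∘ Contains⇒Occurs (parkingPerm v) (parkingWord n (prefs v)) (length-parkingWord n (prefs v)) (parkingPerm≡nth v) {σ = σ} same⇒R

    PkList⇒PkEq : ∀ {n k} → HasCard (PkList R n) k → PkEq n σ k
    PkList⇒PkEq {n} = HasCard-bijection (toVec n) prefs (λ ps (length≡ , ps<n , _) → prefs-toVec n ps length≡ ps<n) (toVec-prefs n)
                                        PkProp⇒PkList PkList⇒PkProp

-- Opened only here: +_ would clash with the sections (x +_) on ℕ used above.
open import Data.Integer using (+_)
open Containment using (Is132⇒SameOrder; SameOrder⇒Is132; Is231⇒SameOrder; SameOrder⇒Is231)
open Transfer using (PkList⇒PkEq)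
open Enumeration using (module PkList132; module PkList231)

mainTheorem1 :
    (p : ℕ → ℕ) →
    p 0 ≡ 1 →
    ((n : ℕ) → p (suc n) ≡ sum1 (suc n) (λ k → k * p (k ∸ 1) * p (suc n ∸ k))) →
    ((n : ℕ) → PkEq n pat132 (p n) × PkEq n pat231 (p n))
    × (let P : FPS
           P = λ n → + p n
       in (n : ℕ) →
            ((((xS ⊛ xS) ⊛ (P ⊛ deriv P)) ⊕ (xS ⊛ (P ⊛ P))) ⊕ ((⊖ P) ⊕ oneS)) n ≡ + 0)
mainTheorem1 p p0 p-suc =
  (λ n → PkList⇒PkEq pat132 Is132⇒SameOrder SameOrder⇒Is132 (PkList132.PkList-card p p0 p-suc n) ,
         PkList⇒PkEq pat231 Is231⇒SameOrder SameOrder⇒Is231 (PkList231.PkList-card p p0 p-suc n)) ,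
  PowerSeries.coefficients-vanish p p0 p-suc
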